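{- The $4\times 4$ rook graph $R_{4,4}$ and the Shrikhande graph have the same magnitude, but different magnitude homology (i.e. there exist $k,l$ with $\mathrm{MH}_{k,l}(R_{4,4})\not\cong\mathrm{MH}_{k,l}(\mathrm{Shr})$).
   Context: $R_{4,4}$ is the Cayley graph on $\mathbb Z/4\mathbb Z\times\mathbb Z/4\mathbb Z$ with generating set $\{(0,x),(x,0):x=1,2,3\}$; the Shrikhande graph $\mathrm{Shr}$ is the Cayley graph on $\mathbb Z/4\mathbb Z\times\mathbb Z/4\mathbb Z$ with generating set $\{\pm(0,1),\pm(1,0),\pm(1,1)\}$. For a finite connected graph $G$ with shortest-path metric $d$, its magnitude $\#G\in\mathbb Z[[q]]$ is the sum of all entries of the inverse of the matrix $Z_G=(q^{d(x,y)})_{x,y\in V(G)}$ over $\mathbb Z[[q]]$. For a tuple of vertices put $\ell(x_0,\ldots,x_k)=\sum_{i} d(x_i,x_{i+1})$; $\mathrm{MC}_{k,l}(G)$ is the free abelian group on tuples $(x_0,\ldots,x_k)$ with $x_i\ne x_{i+1}$ and $\ell=l$, with differential $\partial=\sum_{1\le i\le k-1}(-1)^i\partial_i$, where $\partial_i$ deletes $x_i$ if this preserves $\ell$ and is $0$ otherwise; $\mathrm{MH}_{k,l}(G)=H_k(\mathrm{MC}_{*,l}(G))$. -}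

module Defs where

open import Data.Nat using (ℕ; zero; suc; _∸_; _%_; _≡ᵇ_; _≤ᵇ_)
  renaming (_+_ to _+ℕ_)
open import Data.Integer using (ℤ; 0ℤ; 1ℤ; _+_; _-_; _*_; -_)
open import Data.Fin using (Fin; toℕ)
open import Data.Fin.Properties using () renaming (_≟_ to _≟ᶠ_)
open import Data.Bool using (Bool; true; false; _∧_; _∨_; if_then_else_; not)
open import Data.List using (List; []; _∷_; map; concatMap; foldr; upTo)
open import Data.Bool.ListAction using (any)
open import Data.List.Base using (allFin)
open import Data.Vec using (Vec; []; _∷_; removeAt)
open import Data.Product using (Σ; _×_; _,_; proj₁; proj₂)
open import Data.Product.Properties using (≡-dec)
open import Data.Vec.Properties using () renaming (≡-dec to ≡-decᵛ)
open import Data.Unit using (⊤)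
open import Relation.Nullary using (¬_; Dec; yes; no)
open import Relation.Nullary.Decidable using (⌊_⌋)
open import Relation.Binary.PropositionalEquality using (_≡_; refl; cong; cong₂; sym; trans)
open import Data.Integer.Properties using (+-comm; +-assoc; *-distribʳ-+; neg-distrib-+; neg-distribˡ-*; *-zeroˡ)
open import Algebra.Properties.CommutativeSemigroup Data.Integer.Properties.+-commutativeSemigroup using (interchange)
open import Algebra.Bundles.Raw using (RawGroup)

-- Vertices: ℤ/4 × ℤ/4, represented as Fin 4 × Fin 4

V : Set
V = Fin 4 × Fin 4

_≟V_ : (x y : V) → Dec (x ≡ y)
_≟V_ = ≡-dec _≟ᶠ_ _≟ᶠ_

_==V_ : V → V → Bool
x ==V y = ⌊ x ≟V y ⌋

vertices : List V
vertices = concatMap (λ a → map (λ b → (a , b)) (allFin 4)) (allFin 4)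

diff4 : Fin 4 → Fin 4 → ℕ
diff4 a b = ((4 +ℕ toℕ a) ∸ toℕ b) % 4

-- A generating set is a list of elements of ℤ/4 × ℤ/4 given by
-- representatives in {0,1,2,3}².
GenSet : Set
GenSet = List (ℕ × ℕ)

-- Cayley graph adjacency: x ~ y iff y - x ∈ S
adj : GenSet → V → V → Bool
adj S (x₁ , x₂) (y₁ , y₂) =
  any (λ s → (proj₁ s ≡ᵇ diff4 y₁ x₁) ∧ (proj₂ s ≡ᵇ diff4 y₂ x₂)) S

S-R44 : GenSet
S-R44 = (0 , 1) ∷ (0 , 2) ∷ (0 , 3) ∷ (1 , 0) ∷ (2 , 0) ∷ (3 , 0) ∷ []

S-Shr : GenSet
S-Shr = (0 , 1) ∷ (0 , 3) ∷ (1 , 0) ∷ (3 , 0) ∷ (1 , 1) ∷ (3 , 3) ∷ []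

reach : GenSet → ℕ → V → V → Bool
reach S zero    x y = x ==V y
reach S (suc n) x y = reach S n x y ∨ any (λ z → adj S x z ∧ reach S n z y) vertices

least : (ℕ → Bool) → ℕ → ℕ → ℕ
least p start zero       = start
least p start (suc fuel) = if p start then start else least p (suc start) fuel

-- shortest-path distance (any two vertices of a connected graph on 16
-- vertices are at distance ≤ 15, so searching n = 0..15 suffices)
dist : GenSet → V → V → ℕ
dist S x y = least (λ n → reach S n x y) 0 16

-- Formal power series ℤ[[q]] as coefficient sequences

PS : Set
PS = ℕ → ℤ

sumL : List ℤ → ℤ
sumL = foldr _+_ 0ℤ

_⊛_ : PS → PS → PS
(f ⊛ g) n = sumL (map (λ i → f i * g (n ∸ i)) (upTo (suc n)))

0ps : PS
0ps _ = 0ℤ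

1ps : PS
1ps n = if n ≡ᵇ 0 then 1ℤ else 0ℤ

_⊕_ : PS → PS → PS
(f ⊕ g) n = f n + g n

sumPS : List PS → PS
sumPS = foldr _⊕_ 0ps

qPow : ℕ → PS
qPow d n = if n ≡ᵇ d then 1ℤ else 0ℤ

Matrix : Set
Matrix = V → V → PS

ZG : GenSet → Matrix
ZG S x y = qPow (dist S x y)

idM : Matrix
idM x y = if x ==V y then 1ps else 0ps

_·_ : Matrix → Matrix → Matrix
(A · B) x z = sumPS (map (λ y → A x y ⊛ B y z) vertices)

IsInverse : Matrix → Matrix → Set
IsInverse Z W = ∀ x y n → (Z · W) x y n ≡ idM x y n

sumEntries : Matrix → PS
sumEntries W = sumPS (concatMap (λ x → map (λ y → W x y) vertices) vertices)

IsMagnitude : GenSet → PS → Set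
IsMagnitude S m = Σ Matrix λ W → IsInverse (ZG S) W × (∀ n → m n ≡ sumEntries W n)

allVecs : (n : ℕ) → List (Vec V n)
allVecs zero    = [] ∷ []
allVecs (suc n) = concatMap (λ v → map (v ∷_) (allVecs n)) vertices

len : GenSet → {n : ℕ} → Vec V n → ℕ
len S []            = 0
len S (x ∷ [])      = 0
len S (x ∷ y ∷ xs)  = dist S x y +ℕ len S (y ∷ xs)

consecDistinct : {n : ℕ} → Vec V n → Bool
consecDistinct []           = true
consecDistinct (x ∷ [])     = true
consecDistinct (x ∷ y ∷ xs) = not (x ==V y) ∧ consecDistinct (y ∷ xs)

isGen : GenSet → (k l : ℕ) → Vec V (suc k) → Bool
isGen S k l x = consecDistinct x ∧ (len S x ≡ᵇ l)

Chain : ℕ → Set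
Chain k = Vec V (suc k) → ℤ

InMC : GenSet → (k l : ℕ) → Chain k → Set
InMC S k l c = ∀ x → isGen S k l x ≡ false → c x ≡ 0ℤ

sign : ℕ → ℤ
sign n = if n % 2 ≡ᵇ 0 then 1ℤ else - 1ℤ

_==Vec_ : {n : ℕ} → Vec V n → Vec V n → Bool
x ==Vec y = ⌊ ≡-decᵛ _≟V_ x y ⌋

-- coefficient of y in ∂x, for x a (k+2)-tuple (degree k+1):
-- ∂ = Σ_{1≤i≤k} (-1)^i ∂_i, ∂_i deletes x_i if ℓ is preserved, else 0
bdryCoef : GenSet → (k : ℕ) → Vec V (suc (suc k)) → Vec V (suc k) → ℤ
bdryCoef S k x y =
  sumL (map (λ i → if (1 ≤ᵇ toℕ i) ∧ (toℕ i ≤ᵇ k)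
                      ∧ (len S (removeAt x i) ≡ᵇ len S x)
                      ∧ (removeAt x i ==Vec y)
                   then sign (toℕ i) else 0ℤ)
            (allFin (suc (suc k))))

∂ : GenSet → (k : ℕ) → Chain (suc k) → Chain k
∂ S k c y = sumL (map (λ x → c x * bdryCoef S k x y) (allVecs (suc (suc k))))

IsCycle : GenSet → (k : ℕ) → Chain k → Set
IsCycle S zero    c = ⊤
IsCycle S (suc k) c = ∀ y → ∂ S k c y ≡ 0ℤ

Cycle : GenSet → (k l : ℕ) → Set
Cycle S k l = Σ (Chain k) λ c → InMC S k l c × IsCycle S k c

Homologous : (S : GenSet) (k l : ℕ) → Cycle S k l → Cycle S k l → Set
Homologous S k l (c , _) (c' , _) =
  Σ (Chain (suc k)) λ b → InMC S (suc k) l b × (∀ y → c y - c' y ≡ ∂ S k b y)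

private
  sumL-+ : {A : Set} (f g : A → ℤ) (xs : List A) →
           sumL (map (λ x → f x + g x) xs) ≡ sumL (map f xs) + sumL (map g xs)
  sumL-+ f g []       = refl
  sumL-+ f g (x ∷ xs) = trans (cong (f x + g x +_) (sumL-+ f g xs))
                              (interchange (f x) (g x) _ _)

  sumL-neg : {A : Set} (f : A → ℤ) (xs : List A) →
             sumL (map (λ x → - f x) xs) ≡ - sumL (map f xs)
  sumL-neg f []       = refl
  sumL-neg f (x ∷ xs) = trans (cong (- f x +_) (sumL-neg f xs))
                              (sym (neg-distrib-+ (f x) _))

  sumL-0 : {A : Set} (xs : List A) → sumL (map (λ _ → 0ℤ) xs) ≡ 0ℤ
  sumL-0 []       = refl
  sumL-0 (x ∷ xs) = cong (0ℤ +_) (sumL-0 xs)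

  ∂-+ : (S : GenSet) (k : ℕ) (c c' : Chain (suc k)) (y : Vec V (suc k)) →
        ∂ S k (λ x → c x + c' x) y ≡ ∂ S k c y + ∂ S k c' y
  ∂-+ S k c c' y =
    trans (cong sumL (mapCong (allVecs (suc (suc k)))))
          (sumL-+ (λ x → c x * bdryCoef S k x y) (λ x → c' x * bdryCoef S k x y) (allVecs (suc (suc k))))
    where
    mapCong : (xs : List (Vec V (suc (suc k)))) →
      map (λ x → (c x + c' x) * bdryCoef S k x y) xs
        ≡ map (λ x → c x * bdryCoef S k x y + c' x * bdryCoef S k x y) xs
    mapCong []       = refl
    mapCong (x ∷ xs) = cong₂ _∷_ (*-distribʳ-+ (bdryCoef S k x y) (c x) (c' x)) (mapCong xs)

  ∂-neg : (S : GenSet) (k : ℕ) (c : Chain (suc k)) (y : Vec V (suc k)) →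
          ∂ S k (λ x → - c x) y ≡ - ∂ S k c y
  ∂-neg S k c y =
    trans (cong sumL (mapCong (allVecs (suc (suc k)))))
          (sumL-neg (λ x → c x * bdryCoef S k x y) (allVecs (suc (suc k))))
    where
    mapCong : (xs : List (Vec V (suc (suc k)))) →
      map (λ x → - c x * bdryCoef S k x y) xs
        ≡ map (λ x → - (c x * bdryCoef S k x y)) xs
    mapCong []       = refl
    mapCong (x ∷ xs) = cong₂ _∷_ (sym (neg-distribˡ-* (c x) (bdryCoef S k x y))) (mapCong xs)

  ∂-0 : (S : GenSet) (k : ℕ) (y : Vec V (suc k)) → ∂ S k (λ _ → 0ℤ) y ≡ 0ℤ
  ∂-0 S k y = sumL-0 (allVecs (suc (suc k)))

  addCyc : (S : GenSet) (k l : ℕ) → Cycle S k l → Cycle S k l → Cycle S k l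
  addCyc S k l (c , m , z) (c' , m' , z') =
    (λ x → c x + c' x) , (λ x g → cong₂ _+_ (m x g) (m' x g)) , cyc k c c' z z'
    where
    cyc : (k : ℕ) (c c' : Chain k) → IsCycle S k c → IsCycle S k c' →
          IsCycle S k (λ x → c x + c' x)
    cyc zero    c c' z z' = z
    cyc (suc k) c c' z z' y = trans (∂-+ S k c c' y) (cong₂ _+_ (z y) (z' y))

  negCyc : (S : GenSet) (k l : ℕ) → Cycle S k l → Cycle S k l
  negCyc S k l (c , m , z) = (λ x → - c x) , (λ x g → cong -_ (m x g)) , cyc k c z
    where
    cyc : (k : ℕ) (c : Chain k) → IsCycle S k c → IsCycle S k (λ x → - c x)
    cyc zero    c z = z
    cyc (suc k) c z y = trans (∂-neg S k c y) (cong -_ (z y))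

  zeroCyc : (S : GenSet) (k l : ℕ) → Cycle S k l
  zeroCyc S k l = (λ _ → 0ℤ) , (λ x g → refl) , cyc k
    where
    cyc : (k : ℕ) → IsCycle S k (λ _ → 0ℤ)
    cyc zero    = _
    cyc (suc k) = ∂-0 S k

-- MH_{k,l}(G) = Z_{k,l} / B_{k,l}: the group of cycles with pointwise
-- addition, whose equality is "homologous" (quotient as a setoid)
MH : GenSet → (k l : ℕ) → RawGroup _ _
MH S k l = record
  { Carrier = Cycle S k l
  ; _≈_     = Homologous S k l
  ; _∙_     = addCyc S k l
  ; ε       = zeroCyc S k l
  ; _⁻¹     = negCyc S k l
  }

module Submission where

open import Defs
open import Algebra.Bundles.Raw using (RawGroup)
open import Algebra.Morphism.Structures using (module GroupMorphisms)
open import Data.Bool using (Bool; true; false; _∧_; _∨_; if_then_else_; not; T; T?)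
open import Data.Bool.Properties using (T-≡; ∧-zeroʳ)
open import Data.Fin as Fin using (Fin; toℕ; inject₁; fromℕ; #_)
import Data.Fin.Properties as Fin
open import Data.Integer as ℤ using (ℤ; 0ℤ; 1ℤ; -1ℤ; _+_; _-_; _*_; -_)
open import Data.Integer.Properties
open import Algebra.Properties.CommutativeSemigroup +-commutativeSemigroup using (interchange)
open import Data.Integer.Tactic.RingSolver using (solve-∀)
open import Data.List as List using (List; []; _∷_; map; concatMap; _++_; filterᵇ; allFin; tabulate; replicate; applyUpTo; null)
import Data.List.Properties as List
open import Data.List.Membership.Propositional using (_∈_; lose)
open import Data.List.Membership.Propositional.Properties using (∈-map⁺; ∈-concatMap⁺; ∈-allFin)
open import Data.List.Relation.Binary.Permutation.Propositional as ↭ using (_↭_)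
open import Data.List.Relation.Unary.All as All using (all?)
open import Data.List.Relation.Unary.Any using (here)
open import Data.Nat as ℕ using (ℕ; zero; suc; _≡ᵇ_; _≤ᵇ_; _<ᵇ_; _∸_) renaming (_+_ to _+ℕ_)
import Data.Nat.Properties as ℕ
open import Data.Product using (Σ; ∃-syntax; _×_; _,_; proj₁; proj₂)
import Data.Product.Properties as Product
open import Data.Product.Relation.Binary.Lex.NonStrict using (×-decTotalOrder)
open import Data.List.Sort.InsertionSort (×-decTotalOrder ℕ.≤-decTotalOrder ℕ.≤-decTotalOrder) using (sort)
open import Data.List.Sort.InsertionSort.Properties (×-decTotalOrder ℕ.≤-decTotalOrder ℕ.≤-decTotalOrder) using (sort-↭)
open import Data.Vec as Vec using (Vec; []; _∷_; removeAt; insertAt; lookup)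
import Data.Vec.Properties as Vec
open import Function using (_∘_; id; Equivalence)
open import Level using (Level)
open import Data.Empty using (⊥-elim)
open import Relation.Nullary using (¬_; Dec)
open import Relation.Nullary.Decidable using (True; toWitness; fromWitness; isYes≗does; does)
open import Relation.Unary using (Decidable)
open import Relation.Binary.PropositionalEquality
  using (_≡_; _≢_; refl; sym; trans; cong; cong₂; subst; module ≡-Reasoning)

-- Both graphs are strongly regular with parameters (16, 6, 2, 2) and have diameter 2, so for
-- vertices x, y at distance k the multiset {(d(x,z), d(z,y)) : z} depends only on k, and is the
-- same for both graphs. Grouping Σ_z q^d(x,z) W(z,y) by these pairs shows that W(x,y) = w_d(x,y),
-- for power series w₀, w₁, w₂ defined by one recursion, inverts Z_G in both graphs; hence the
-- magnitudes agree.
--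
-- MH_{3,4} tells the graphs apart. In R_{4,4} an explicit map h : MC_{3,4} → MC_{4,4} satisfies
-- ∂(h c) = c for every cycle c, so every cycle bounds. In the Shrikhande graph the tuple
-- (0,0),(1,0),(3,1),(0,2) is a cycle, since deleting any interior vertex shortens it, and an
-- explicit functional on MC_{3,4} that vanishes on all boundaries takes the value 1 on it.
-- Both explicit objects were found by computer; the identities they satisfy are verified by
-- evaluation, through the formula ∂b(y) = Σ_j (−1)^(j+1) Σ_v b(y with v inserted after y_j),
-- v ranging over the vertices strictly between y_j and y_(j+1).

opaque
  ∑ : {A : Set} → List A → (A → ℤ) → ℤ
  ∑ xs f = sumL (map f xs)

syntax ∑ xs (λ x → e) = ∑[ x ← xs ] e

opaque
  unfolding ∑

  ∑-sumL : {A : Set} (xs : List A) (f : A → ℤ) → ∑ xs f ≡ sumL (map f xs)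
  ∑-sumL xs f = refl

  ∑-[] : {A : Set} (f : A → ℤ) → ∑ [] f ≡ 0ℤ
  ∑-[] f = refl

  ∑-∷ : {A : Set} (x : A) (xs : List A) (f : A → ℤ) → ∑ (x ∷ xs) f ≡ f x + ∑ xs f
  ∑-∷ x xs f = refl

  ∑-cong : {A : Set} (xs : List A) {f g : A → ℤ} → (∀ x → f x ≡ g x) → ∑ xs f ≡ ∑ xs g
  ∑-cong []       f≗g = refl
  ∑-cong (x ∷ xs) f≗g = cong₂ _+_ (f≗g x) (∑-cong xs f≗g)

  ∑-++ : {A : Set} (xs ys : List A) (f : A → ℤ) → ∑ (xs ++ ys) f ≡ ∑ xs f + ∑ ys f
  ∑-++ []       ys f = sym (+-identityˡ _)
  ∑-++ (x ∷ xs) ys f = trans (cong (f x +_) (∑-++ xs ys f)) (sym (+-assoc (f x) _ _))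

  ∑-map : {A B : Set} (xs : List A) (g : A → B) (f : B → ℤ) → ∑ (map g xs) f ≡ ∑ xs (f ∘ g)
  ∑-map []       g f = refl
  ∑-map (x ∷ xs) g f = cong (f (g x) +_) (∑-map xs g f)

  ∑-0 : {A : Set} (xs : List A) → ∑[ _ ← xs ] 0ℤ ≡ 0ℤ
  ∑-0 []       = refl
  ∑-0 (x ∷ xs) = trans (+-identityˡ _) (∑-0 xs)

  ∑-+ : {A : Set} (xs : List A) (f g : A → ℤ) → ∑[ x ← xs ] (f x + g x) ≡ ∑ xs f + ∑ xs g
  ∑-+ []       f g = refl
  ∑-+ (x ∷ xs) f g = trans (cong (f x + g x +_) (∑-+ xs f g)) (interchange (f x) (g x) _ _)

  ∑-*ˡ : {A : Set} (xs : List A) (c : ℤ) (f : A → ℤ) → ∑[ x ← xs ] (c * f x) ≡ c * ∑ xs f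
  ∑-*ˡ []       c f = sym (*-zeroʳ c)
  ∑-*ˡ (x ∷ xs) c f = trans (cong (c * f x +_) (∑-*ˡ xs c f)) (sym (*-distribˡ-+ c (f x) _))

  ∑-filterᵇ : {A : Set} (p : A → Bool) (xs : List A) (f : A → ℤ) →
              ∑ (filterᵇ p xs) f ≡ ∑[ x ← xs ] (if p x then f x else 0ℤ)
  ∑-filterᵇ p []       f = refl
  ∑-filterᵇ p (x ∷ xs) f with p x
  ... | true  = cong (f x +_) (∑-filterᵇ p xs f)
  ... | false = trans (∑-filterᵇ p xs f) (sym (+-identityˡ _))

  ∑-↭ : {A : Set} {xs ys : List A} (f : A → ℤ) → xs ↭ ys → ∑ xs f ≡ ∑ ys f
  ∑-↭ f ↭.refl              = refl
  ∑-↭ f (↭.prep x p)        = cong (f x +_) (∑-↭ f p)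
  ∑-↭ f (↭.swap {xs} {ys} x y p) = begin
    f x + (f y + ∑ xs f)  ≡⟨ sym (+-assoc (f x) (f y) _) ⟩
    f x + f y + ∑ xs f    ≡⟨ cong₂ _+_ (+-comm (f x) (f y)) (∑-↭ f p) ⟩
    f y + f x + ∑ ys f    ≡⟨ +-assoc (f y) (f x) _ ⟩
    f y + (f x + ∑ ys f)  ∎
    where open ≡-Reasoning
  ∑-↭ f (↭.trans p q)       = trans (∑-↭ f p) (∑-↭ f q)

∑-concatMap : {A B : Set} (xs : List A) (g : A → List B) (f : B → ℤ) →
              ∑ (concatMap g xs) f ≡ ∑[ x ← xs ] ∑ (g x) f
∑-concatMap []       g f = trans (∑-[] f) (sym (∑-[] _))
∑-concatMap (x ∷ xs) g f = begin
  ∑ (g x ++ concatMap g xs) f            ≡⟨ ∑-++ (g x) (concatMap g xs) f ⟩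
  ∑ (g x) f + ∑ (concatMap g xs) f       ≡⟨ cong (∑ (g x) f +_) (∑-concatMap xs g f) ⟩
  ∑ (g x) f + ∑[ x′ ← xs ] ∑ (g x′) f    ≡⟨ sym (∑-∷ x xs _) ⟩
  ∑[ x′ ← x ∷ xs ] ∑ (g x′) f            ∎
  where open ≡-Reasoning

∑-swap : {A B : Set} (xs : List A) (ys : List B) (F : A → B → ℤ) →
         ∑[ x ← xs ] ∑[ y ← ys ] F x y ≡ ∑[ y ← ys ] ∑[ x ← xs ] F x y
∑-swap []       ys F = trans (∑-[] _) (sym (trans (∑-cong ys (λ y → ∑-[] _)) (∑-0 ys)))
∑-swap (x ∷ xs) ys F = begin
  ∑[ x′ ← x ∷ xs ] ∑ ys (F x′)                           ≡⟨ ∑-∷ x xs _ ⟩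
  ∑ ys (F x) + ∑[ x′ ← xs ] ∑ ys (F x′)                  ≡⟨ cong (∑ ys (F x) +_) (∑-swap xs ys F) ⟩
  ∑ ys (F x) + ∑[ y ← ys ] ∑[ x′ ← xs ] F x′ y           ≡⟨ sym (∑-+ ys (F x) _) ⟩
  ∑[ y ← ys ] (F x y + ∑[ x′ ← xs ] F x′ y)              ≡⟨ ∑-cong ys (λ y → sym (∑-∷ x xs (λ x′ → F x′ y))) ⟩
  ∑[ y ← ys ] ∑[ x′ ← x ∷ xs ] F x′ y                    ∎
  where open ≡-Reasoning

∑-allFin-suc : (n : ℕ) (F : Fin (suc n) → ℤ) →
               ∑ (allFin (suc n)) F ≡ F Fin.zero + ∑ (allFin n) (F ∘ Fin.suc)
∑-allFin-suc n F =
  trans (∑-∷ Fin.zero (tabulate Fin.suc) F)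
        (cong (F Fin.zero +_) (trans (∑-sumL _ F) (trans (cong sumL tabulate-map) (sym (∑-sumL _ (F ∘ Fin.suc))))))
  where
  tabulate-map : map F (tabulate Fin.suc) ≡ map (F ∘ Fin.suc) (allFin n)
  tabulate-map = trans (List.map-tabulate Fin.suc F) (sym (List.map-tabulate id (F ∘ Fin.suc)))

∑-allFin-last : (n : ℕ) (F : Fin (suc n) → ℤ) →
                ∑ (allFin (suc n)) F ≡ ∑ (allFin n) (F ∘ inject₁) + F (fromℕ n)
∑-allFin-last zero    F = begin
  ∑ (allFin 1) F                  ≡⟨ ∑-allFin-suc zero F ⟩
  F Fin.zero + ∑ [] (F ∘ Fin.suc) ≡⟨ cong (F Fin.zero +_) (∑-[] _) ⟩
  F Fin.zero + 0ℤ                 ≡⟨ +-comm (F Fin.zero) 0ℤ ⟩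
  0ℤ + F Fin.zero                 ≡⟨ cong (_+ F Fin.zero) (sym (∑-[] _)) ⟩
  ∑ [] (F ∘ inject₁) + F Fin.zero ∎
  where open ≡-Reasoning
∑-allFin-last (suc n) F = begin
  ∑ (allFin (suc (suc n))) F
    ≡⟨ ∑-allFin-suc (suc n) F ⟩
  F Fin.zero + ∑ (allFin (suc n)) (F ∘ Fin.suc)
    ≡⟨ cong (F Fin.zero +_) (∑-allFin-last n (F ∘ Fin.suc)) ⟩
  F Fin.zero + (∑ (allFin n) (F ∘ Fin.suc ∘ inject₁) + F (fromℕ (suc n)))
    ≡⟨ sym (+-assoc (F Fin.zero) _ _) ⟩
  F Fin.zero + ∑ (allFin n) (F ∘ Fin.suc ∘ inject₁) + F (fromℕ (suc n))
    ≡⟨ cong (_+ F (fromℕ (suc n))) (sym (∑-allFin-suc n (F ∘ inject₁))) ⟩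
  ∑ (allFin (suc n)) (F ∘ inject₁) + F (fromℕ (suc n)) ∎
  where open ≡-Reasoning

==V⇒≡ : {x y : V} → x ==V y ≡ true → x ≡ y
==V⇒≡ e = toWitness (Equivalence.from T-≡ e)

==V-refl : (x : V) → x ==V x ≡ true
==V-refl x = Equivalence.to T-≡ (fromWitness {a? = x ≟V x} refl)

==Vec⇒≡ : {n : ℕ} {x y : Vec V n} → x ==Vec y ≡ true → x ≡ y
==Vec⇒≡ e = toWitness (Equivalence.from T-≡ e)

==Vec-∷ : {n : ℕ} (x y : V) (xs ys : Vec V n) → (x ∷ xs) ==Vec (y ∷ ys) ≡ (x ==V y) ∧ (xs ==Vec ys)
==Vec-∷ x y xs ys =
  trans (isYes≗does (Vec.≡-dec _≟V_ (x ∷ xs) (y ∷ ys)))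
        (sym (cong₂ _∧_ (isYes≗does (x ≟V y)) (isYes≗does (Vec.≡-dec _≟V_ xs ys))))

if-∧ : {A : Set} (a b : Bool) (z w : A) → (if a ∧ b then z else w) ≡ (if a then (if b then z else w) else w)
if-∧ true  b z w = refl
if-∧ false b z w = refl

∑-if : {A : Set} (xs : List A) (b : Bool) (f : A → ℤ) →
       ∑[ x ← xs ] (if b then f x else 0ℤ) ≡ (if b then ∑ xs f else 0ℤ)
∑-if xs true  f = refl
∑-if xs false f = ∑-0 xs

*-if : (a : ℤ) (b : Bool) (z : ℤ) → a * (if b then z else 0ℤ) ≡ (if b then a * z else 0ℤ)
*-if a true  z = refl
*-if a false z = *-zeroʳ a

vertices-complete : (x : V) → x ∈ vertices
vertices-complete (a , b) =
  ∈-concatMap⁺ (λ a′ → map (a′ ,_) (allFin 4)) (lose (∈-allFin a) (∈-map⁺ (a ,_) (∈-allFin b)))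

allVecs-complete : {n : ℕ} (x : Vec V n) → x ∈ allVecs n
allVecs-complete []       = here refl
allVecs-complete (v ∷ xs) =
  ∈-concatMap⁺ (λ v′ → map (v′ ∷_) (allVecs _)) (lose (vertices-complete v) (∈-map⁺ (v ∷_) (allVecs-complete xs)))

decide-∀ : {A : Set} {P : A → Set} (P? : Decidable P) (xs : List A) → (∀ x → x ∈ xs) →
           {True (all? P? xs)} → ∀ x → P x
decide-∀ P? xs complete {ok} x = All.lookup (toWitness ok) (complete x)

decide-∀V² : {P : V → V → Set} (P? : ∀ x y → Dec (P x y)) →
             {True (all? (λ x → all? (P? x) vertices) vertices)} → ∀ x y → P x y
decide-∀V² P? {ok} x y = All.lookup (All.lookup (toWitness ok) (vertices-complete x)) (vertices-complete y)

vertices-unique : (y : V) → filterᵇ (_==V y) vertices ≡ y ∷ []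
vertices-unique = decide-∀ (λ y → List.≡-dec _≟V_ (filterᵇ (_==V y) vertices) (y ∷ [])) vertices vertices-complete

∑-vertices-indicator : (y : V) (H : V → ℤ) → ∑[ v ← vertices ] (if v ==V y then H v else 0ℤ) ≡ H y
∑-vertices-indicator y H = begin
  ∑[ v ← vertices ] (if v ==V y then H v else 0ℤ)  ≡⟨ sym (∑-filterᵇ (_==V y) vertices H) ⟩
  ∑ (filterᵇ (_==V y) vertices) H                   ≡⟨ cong (λ l → ∑ l H) (vertices-unique y) ⟩
  ∑ (y ∷ []) H                                      ≡⟨ trans (∑-∷ y [] H) (cong (H y +_) (∑-[] H)) ⟩
  H y + 0ℤ                                          ≡⟨ +-identityʳ (H y) ⟩
  H y                                               ∎
  where open ≡-Reasoning

∑-allVecs-suc : (n : ℕ) (F : Vec V (suc n) → ℤ) →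
                ∑ (allVecs (suc n)) F ≡ ∑[ v ← vertices ] ∑[ xs ← allVecs n ] F (v ∷ xs)
∑-allVecs-suc n F =
  trans (∑-concatMap vertices (λ v → map (v ∷_) (allVecs n)) F)
        (∑-cong vertices (λ v → ∑-map (allVecs n) (v ∷_) F))

∑-allVecs-indicator : (n : ℕ) (y : Vec V n) (G : Vec V n → ℤ) →
                      ∑[ x ← allVecs n ] (if x ==Vec y then G x else 0ℤ) ≡ G y
∑-allVecs-indicator zero [] G = trans (∑-∷ [] [] _) (trans (cong (G [] +_) (∑-[] _)) (+-identityʳ (G [])))
∑-allVecs-indicator (suc n) (y ∷ ys) G = begin
  ∑[ x ← allVecs (suc n) ] (if x ==Vec (y ∷ ys) then G x else 0ℤ)
    ≡⟨ ∑-allVecs-suc n _ ⟩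
  ∑[ v ← vertices ] ∑[ xs ← allVecs n ] (if (v ∷ xs) ==Vec (y ∷ ys) then G (v ∷ xs) else 0ℤ)
    ≡⟨ ∑-cong vertices (λ v → ∑-cong (allVecs n) (λ xs →
         trans (cong (λ b → if b then G (v ∷ xs) else 0ℤ) (==Vec-∷ v y xs ys)) (if-∧ (v ==V y) _ _ _))) ⟩
  ∑[ v ← vertices ] ∑[ xs ← allVecs n ] (if v ==V y then (if xs ==Vec ys then G (v ∷ xs) else 0ℤ) else 0ℤ)
    ≡⟨ ∑-cong vertices (λ v → ∑-if (allVecs n) (v ==V y) _) ⟩
  ∑[ v ← vertices ] (if v ==V y then ∑[ xs ← allVecs n ] (if xs ==Vec ys then G (v ∷ xs) else 0ℤ) else 0ℤ)
    ≡⟨ ∑-cong vertices (λ v → cong (λ z → if v ==V y then z else 0ℤ) (∑-allVecs-indicator n ys (G ∘ (v ∷_)))) ⟩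
  ∑[ v ← vertices ] (if v ==V y then G (v ∷ ys) else 0ℤ)
    ≡⟨ ∑-vertices-indicator y (λ v → G (v ∷ ys)) ⟩
  G (y ∷ ys) ∎
  where open ≡-Reasoning

removeAt-suc : {A : Set} {n : ℕ} (v : A) (xs : Vec A (suc n)) (j : Fin (suc n)) →
               removeAt (v ∷ xs) (Fin.suc j) ≡ v ∷ removeAt xs j
removeAt-suc v (x ∷ xs) j = refl

∑-removeAt-fibre : (n : ℕ) (i : Fin (suc n)) (y : Vec V n) (F : Vec V (suc n) → ℤ) →
                   ∑[ x ← allVecs (suc n) ] (if removeAt x i ==Vec y then F x else 0ℤ)
                   ≡ ∑[ v ← vertices ] F (insertAt y i v)
∑-removeAt-fibre n Fin.zero y F =
  trans (∑-allVecs-suc n _) (∑-cong vertices (λ v → ∑-allVecs-indicator n y (F ∘ (v ∷_))))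
∑-removeAt-fibre (suc m) (Fin.suc j) (y ∷ ys) F = begin
  ∑[ x ← allVecs (suc (suc m)) ] (if removeAt x (Fin.suc j) ==Vec (y ∷ ys) then F x else 0ℤ)
    ≡⟨ ∑-allVecs-suc (suc m) _ ⟩
  ∑[ v ← vertices ] ∑[ xs ← allVecs (suc m) ] (if removeAt (v ∷ xs) (Fin.suc j) ==Vec (y ∷ ys) then F (v ∷ xs) else 0ℤ)
    ≡⟨ ∑-cong vertices (λ v → ∑-cong (allVecs (suc m)) (λ xs →
         trans (cong (λ b → if b then F (v ∷ xs) else 0ℤ)
                     (trans (cong (_==Vec (y ∷ ys)) (removeAt-suc v xs j)) (==Vec-∷ v y (removeAt xs j) ys)))
               (if-∧ (v ==V y) _ _ _))) ⟩
  ∑[ v ← vertices ] ∑[ xs ← allVecs (suc m) ] (if v ==V y then (if removeAt xs j ==Vec ys then F (v ∷ xs) else 0ℤ) else 0ℤ)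
    ≡⟨ ∑-cong vertices (λ v → ∑-if (allVecs (suc m)) (v ==V y) _) ⟩
  ∑[ v ← vertices ] (if v ==V y then ∑[ xs ← allVecs (suc m) ] (if removeAt xs j ==Vec ys then F (v ∷ xs) else 0ℤ) else 0ℤ)
    ≡⟨ ∑-cong vertices (λ v → cong (λ z → if v ==V y then z else 0ℤ) (∑-removeAt-fibre m j ys (F ∘ (v ∷_)))) ⟩
  ∑[ v ← vertices ] (if v ==V y then ∑[ w ← vertices ] F (v ∷ insertAt ys j w) else 0ℤ)
    ≡⟨ ∑-vertices-indicator y (λ v → ∑[ w ← vertices ] F (v ∷ insertAt ys j w)) ⟩
  ∑[ w ← vertices ] F (y ∷ insertAt ys j w) ∎
  where open ≡-Reasoning

-- Formal ℤ-combinations of tuples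

Formal : ℕ → Set
Formal n = List (Vec V n × ℤ)

scale : {n : ℕ} → ℤ → Formal n → Formal n
scale s []            = []
scale s ((z , t) ∷ L) = (z , s * t) ∷ scale s L

units : {n : ℕ} → List (Vec V n) → Formal n
units = map (_, 1ℤ)

bind : {m n : ℕ} → (Vec V m → Formal n) → Formal m → Formal n
bind G = concatMap (λ zt → scale (proj₂ zt) (G (proj₁ zt)))

insertTerm : {n : ℕ} → Vec V n × ℤ → Formal n → Formal n
insertTerm (z , t) []              = (z , t) ∷ []
insertTerm (z , t) ((z′ , t′) ∷ L) =
  if z ==Vec z′ then (z′ , t + t′) ∷ L else (z′ , t′) ∷ insertTerm (z , t) L

isZero : ℤ → Bool
isZero (ℤ.+ zero) = true
isZero _          = false

dropZeros : {n : ℕ} → Formal n → Formal n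
dropZeros []            = []
dropZeros ((z , t) ∷ L) = if isZero t then dropZeros L else (z , t) ∷ dropZeros L

normalise : {n : ℕ} → Formal n → Formal n
normalise L = dropZeros (List.foldr insertTerm [] L)

opaque
  eval : {n : ℕ} → (Vec V n → ℤ) → Formal n → ℤ
  eval c []             = 0ℤ
  eval c ((z , t) ∷ L) = t * c z + eval c L

opaque
  unfolding eval

  eval-[] : {n : ℕ} (c : Vec V n → ℤ) → eval c [] ≡ 0ℤ
  eval-[] c = refl

  eval-∷ : {n : ℕ} (c : Vec V n → ℤ) (z : Vec V n) (t : ℤ) (L : Formal n) →
           eval c ((z , t) ∷ L) ≡ t * c z + eval c L
  eval-∷ c z t L = refl

  eval-++ : {n : ℕ} (c : Vec V n → ℤ) (L M : Formal n) → eval c (L ++ M) ≡ eval c L + eval c M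
  eval-++ c []            M = sym (+-identityˡ _)
  eval-++ c ((z , t) ∷ L) M = trans (cong (t * c z +_) (eval-++ c L M)) (sym (+-assoc (t * c z) _ _))

  eval-units : {n : ℕ} (c : Vec V n → ℤ) (zs : List (Vec V n)) → eval c (units zs) ≡ ∑ zs c
  eval-units c []       = sym (∑-[] c)
  eval-units c (z ∷ zs) = trans (cong₂ _+_ (*-identityˡ (c z)) (eval-units c zs)) (sym (∑-∷ z zs c))

  eval-scale : {n : ℕ} (c : Vec V n → ℤ) (s : ℤ) (L : Formal n) → eval c (scale s L) ≡ s * eval c L
  eval-scale c s []            = sym (*-zeroʳ s)
  eval-scale c s ((z , t) ∷ L) =
    trans (cong₂ _+_ (*-assoc s t (c z)) (eval-scale c s L)) (sym (*-distribˡ-+ s (t * c z) _))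

  eval-cong : {n : ℕ} {c c′ : Vec V n → ℤ} (L : Formal n) → (∀ z → c z ≡ c′ z) → eval c L ≡ eval c′ L
  eval-cong []            c≗c′ = refl
  eval-cong ((z , t) ∷ L) c≗c′ = cong₂ _+_ (cong (t *_) (c≗c′ z)) (eval-cong L c≗c′)

  eval-- : {n : ℕ} (c c′ : Vec V n → ℤ) (L : Formal n) → eval (λ z → c z - c′ z) L ≡ eval c L - eval c′ L
  eval-- c c′ []            = refl
  eval-- c c′ ((z , t) ∷ L) = begin
    t * (c z - c′ z) + eval (λ z → c z - c′ z) L   ≡⟨ cong₂ _+_ (*-distribˡ-+ t (c z) (- c′ z)) (eval-- c c′ L) ⟩
    t * c z + t * - c′ z + (eval c L - eval c′ L)  ≡⟨ cong (λ u → t * c z + u + (eval c L - eval c′ L)) (sym (neg-distribʳ-* t (c′ z))) ⟩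
    t * c z - t * c′ z + (eval c L - eval c′ L)    ≡⟨ interchange (t * c z) _ _ _ ⟩
    t * c z + eval c L + (- (t * c′ z) - eval c′ L) ≡⟨ cong (t * c z + eval c L +_) (sym (neg-distrib-+ (t * c′ z) _)) ⟩
    t * c z + eval c L - (t * c′ z + eval c′ L)    ∎
    where open ≡-Reasoning

  eval-insertTerm : {n : ℕ} (c : Vec V n → ℤ) (zt : Vec V n × ℤ) (L : Formal n) →
                    eval c (insertTerm zt L) ≡ eval c (zt ∷ L)
  eval-insertTerm c (z , t) [] = refl
  eval-insertTerm c (z , t) ((z′ , t′) ∷ L) with z ==Vec z′ in e
  ... | true rewrite ==Vec⇒≡ e = begin
    (t + t′) * c z′ + eval c L        ≡⟨ cong (_+ eval c L) (*-distribʳ-+ (c z′) t t′) ⟩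
    t * c z′ + t′ * c z′ + eval c L   ≡⟨ +-assoc (t * c z′) _ _ ⟩
    t * c z′ + (t′ * c z′ + eval c L) ∎
    where open ≡-Reasoning
  ... | false = begin
    t′ * c z′ + eval c (insertTerm (z , t) L)  ≡⟨ cong (t′ * c z′ +_) (eval-insertTerm c (z , t) L) ⟩
    t′ * c z′ + (t * c z + eval c L)           ≡⟨ sym (+-assoc (t′ * c z′) _ _) ⟩
    t′ * c z′ + t * c z + eval c L             ≡⟨ cong (_+ eval c L) (+-comm (t′ * c z′) _) ⟩
    t * c z + t′ * c z′ + eval c L             ≡⟨ +-assoc (t * c z) _ _ ⟩
    t * c z + (t′ * c z′ + eval c L)           ∎
    where open ≡-Reasoning

  eval-dropZeros : {n : ℕ} (c : Vec V n → ℤ) (L : Formal n) → eval c (dropZeros L) ≡ eval c L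
  eval-dropZeros c []                         = refl
  eval-dropZeros c ((z , ℤ.+ zero) ∷ L)       = trans (eval-dropZeros c L) (sym (+-identityˡ _))
  eval-dropZeros c ((z , t@(ℤ.+ suc _)) ∷ L)  = cong (t * c z +_) (eval-dropZeros c L)
  eval-dropZeros c ((z , t@(ℤ.-[1+ _ ])) ∷ L) = cong (t * c z +_) (eval-dropZeros c L)

eval-concatMap : {A : Set} {n : ℕ} (c : Vec V n → ℤ) (xs : List A) (F : A → Formal n) →
                 eval c (concatMap F xs) ≡ ∑[ x ← xs ] eval c (F x)
eval-concatMap c []       F = trans (eval-[] c) (sym (∑-[] _))
eval-concatMap c (x ∷ xs) F =
  trans (eval-++ c (F x) _) (trans (cong (eval c (F x) +_) (eval-concatMap c xs F)) (sym (∑-∷ x xs _)))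

eval-foldr-insertTerm : {n : ℕ} (c : Vec V n → ℤ) (L : Formal n) →
                        eval c (List.foldr insertTerm [] L) ≡ eval c L
eval-foldr-insertTerm c []             = refl
eval-foldr-insertTerm c ((z , t) ∷ L) =
  trans (eval-insertTerm c (z , t) _)
        (trans (eval-∷ c z t _) (trans (cong (t * c z +_) (eval-foldr-insertTerm c L)) (sym (eval-∷ c z t L))))

eval-normalise : {n : ℕ} (c : Vec V n → ℤ) (L : Formal n) → eval c (normalise L) ≡ eval c L
eval-normalise c L = trans (eval-dropZeros c _) (eval-foldr-insertTerm c L)

eval-vanishes : {n : ℕ} (c : Vec V n → ℤ) (L : Formal n) → normalise L ≡ [] → eval c L ≡ 0ℤ
eval-vanishes c L L≈0 = trans (sym (eval-normalise c L)) (trans (cong (eval c) L≈0) (eval-[] c))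

eval-bind : {m n : ℕ} (c : Vec V n → ℤ) (G : Vec V m → Formal n) (L : Formal m) →
            eval c (bind G L) ≡ eval (λ z → eval c (G z)) L
eval-bind c G []            = trans (eval-[] c) (sym (eval-[] _))
eval-bind c G ((z , t) ∷ L) = begin
  eval c (scale t (G z) ++ bind G L)                 ≡⟨ eval-++ c (scale t (G z)) _ ⟩
  eval c (scale t (G z)) + eval c (bind G L)         ≡⟨ cong₂ _+_ (eval-scale c t (G z)) (eval-bind c G L) ⟩
  t * eval c (G z) + eval (λ z → eval c (G z)) L     ≡⟨ sym (eval-∷ _ z t L) ⟩
  eval (λ z → eval c (G z)) ((z , t) ∷ L)            ∎
  where open ≡-Reasoning

eval-difference : {n : ℕ} (c : Vec V n → ℤ) (L M : Formal n) → eval c (L ++ scale -1ℤ M) ≡ 0ℤ → eval c L ≡ eval c M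
eval-difference c L M L-M≡0 = i-j≡0⇒i≡j (eval c L) (eval c M) (begin
  eval c L - eval c M              ≡⟨ cong (eval c L +_) (sym (-1*i≡-i (eval c M))) ⟩
  eval c L + -1ℤ * eval c M        ≡⟨ cong (eval c L +_) (sym (eval-scale c -1ℤ M)) ⟩
  eval c L + eval c (scale -1ℤ M)  ≡⟨ sym (eval-++ c L (scale -1ℤ M)) ⟩
  eval c (L ++ scale -1ℤ M)        ≡⟨ L-M≡0 ⟩
  0ℤ                               ∎)
  where open ≡-Reasoning

eval-zero : {n : ℕ} (L : Formal n) → eval (λ _ → 0ℤ) L ≡ 0ℤ
eval-zero []            = eval-[] _
eval-zero ((z , t) ∷ L) = trans (eval-∷ _ z t L) (cong₂ _+_ (*-zeroʳ t) (eval-zero L))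

-- The differential through insertions

faceCoefficient : GenSet → (k : ℕ) → Vec V (suc (suc k)) → Fin (suc (suc k)) → ℤ
faceCoefficient S k x i =
  if (1 ≤ᵇ toℕ i) ∧ (toℕ i ≤ᵇ k) ∧ (len S (removeAt x i) ≡ᵇ len S x) then sign (toℕ i) else 0ℤ

bdryCoef-faces : (S : GenSet) (k : ℕ) (x : Vec V (suc (suc k))) (y : Vec V (suc k)) →
                 bdryCoef S k x y ≡ ∑[ i ← allFin (suc (suc k)) ] (if removeAt x i ==Vec y then faceCoefficient S k x i else 0ℤ)
bdryCoef-faces S k x y = trans (sym (∑-sumL _ _)) (∑-cong (allFin (suc (suc k))) (λ i →
  split (1 ≤ᵇ toℕ i) (toℕ i ≤ᵇ k) (len S (removeAt x i) ≡ᵇ len S x) (removeAt x i ==Vec y) (sign (toℕ i))))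
  where
  split : (a b c d : Bool) (s : ℤ) → (if a ∧ b ∧ c ∧ d then s else 0ℤ) ≡ (if d then (if a ∧ b ∧ c then s else 0ℤ) else 0ℤ)
  split true  true  true  d     s = refl
  split true  true  false true  s = refl
  split true  true  false false s = refl
  split true  false c     true  s = refl
  split true  false c     false s = refl
  split false b     c     true  s = refl
  split false b     c     false s = refl

∂-insertions : (S : GenSet) (k : ℕ) (b : Chain (suc k)) (y : Vec V (suc k)) →
               ∂ S k b y ≡ ∑[ i ← allFin (suc (suc k)) ] ∑[ v ← vertices ] (b (insertAt y i v) * faceCoefficient S k (insertAt y i v) i)
∂-insertions S k b y = begin
  ∂ S k b y
    ≡⟨ sym (∑-sumL _ _) ⟩
  ∑[ x ← tuples ] (b x * bdryCoef S k x y)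
    ≡⟨ ∑-cong tuples (λ x → cong (b x *_) (bdryCoef-faces S k x y)) ⟩
  ∑[ x ← tuples ] (b x * ∑[ i ← faces ] (if removeAt x i ==Vec y then faceCoefficient S k x i else 0ℤ))
    ≡⟨ ∑-cong tuples (λ x → sym (∑-*ˡ faces (b x) _)) ⟩
  ∑[ x ← tuples ] ∑[ i ← faces ] (b x * (if removeAt x i ==Vec y then faceCoefficient S k x i else 0ℤ))
    ≡⟨ ∑-swap tuples faces _ ⟩
  ∑[ i ← faces ] ∑[ x ← tuples ] (b x * (if removeAt x i ==Vec y then faceCoefficient S k x i else 0ℤ))
    ≡⟨ ∑-cong faces (λ i → ∑-cong tuples (λ x → *-if (b x) (removeAt x i ==Vec y) _)) ⟩
  ∑[ i ← faces ] ∑[ x ← tuples ] (if removeAt x i ==Vec y then b x * faceCoefficient S k x i else 0ℤ)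
    ≡⟨ ∑-cong faces (λ i → ∑-removeAt-fibre (suc k) i y (λ x → b x * faceCoefficient S k x i)) ⟩
  ∑[ i ← faces ] ∑[ v ← vertices ] (b (insertAt y i v) * faceCoefficient S k (insertAt y i v) i) ∎
  where
  open ≡-Reasoning
  tuples = allVecs (suc (suc k))
  faces  = allFin (suc (suc k))

strictlyBetween : (V → V → ℕ) → V → V → V → Bool
strictlyBetween d u w v = (d u w ≡ᵇ d u v +ℕ d v w) ∧ not (v ==V u) ∧ not (v ==V w)

-- Opaque, since conversion checks that unfold it also unfold dist, at exponential cost.
opaque
  interval : (V → V → ℕ) → V → V → List V
  interval d u w = filterᵇ (strictlyBetween d u w) vertices

  interval-filterᵇ : (d : V → V → ℕ) (u w : V) → interval d u w ≡ filterᵇ (strictlyBetween d u w) vertices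
  interval-filterᵇ d u w = refl

filterᵇ-cong : {A : Set} {p q : A → Bool} → (∀ x → p x ≡ q x) → (xs : List A) → filterᵇ p xs ≡ filterᵇ q xs
filterᵇ-cong p≗q []       = refl
filterᵇ-cong {p = p} {q} p≗q (x ∷ xs) with p x | q x | p≗q x
... | true  | .true  | refl = cong (x ∷_) (filterᵇ-cong p≗q xs)
... | false | .false | refl = filterᵇ-cong p≗q xs

interval-cong : {d d′ : V → V → ℕ} → (∀ x y → d x y ≡ d′ x y) → ∀ u w → interval d u w ≡ interval d′ u w
interval-cong {d} {d′} d≗d′ u w = begin
  interval d u w                             ≡⟨ interval-filterᵇ d u w ⟩
  filterᵇ (strictlyBetween d u w) vertices   ≡⟨ filterᵇ-cong between-cong vertices ⟩
  filterᵇ (strictlyBetween d′ u w) vertices  ≡⟨ sym (interval-filterᵇ d′ u w) ⟩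
  interval d′ u w                            ∎
  where
  open ≡-Reasoning
  between-cong : ∀ v → strictlyBetween d u w v ≡ strictlyBetween d′ u w v
  between-cong v = cong (λ b → b ∧ not (v ==V u) ∧ not (v ==V w))
                        (cong₂ _≡ᵇ_ (d≗d′ u w) (cong₂ _+ℕ_ (d≗d′ u v) (d≗d′ v w)))

-- Every x having y as an interior face, with the coefficient of y in ∂x, when I u w lists the
-- vertices strictly between u and w.
cofaces : (V → V → List V) → (k : ℕ) → Vec V (suc k) → Formal (suc (suc k))
cofaces I k y = concatMap (λ j → scale (sign (suc (toℕ j))) (units (map (insertAt y (Fin.suc (inject₁ j)))
                                   (I (lookup y (inject₁ j)) (lookup y (Fin.suc j))))))
                          (allFin k)

≡ᵇ-+ˡ : (p m n : ℕ) → (p +ℕ m ≡ᵇ p +ℕ n) ≡ (m ≡ᵇ n)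
≡ᵇ-+ˡ zero    m n = refl
≡ᵇ-+ˡ (suc p) m n = ≡ᵇ-+ˡ p m n

≡ᵇ-+ʳ : (m n r : ℕ) → (m +ℕ r ≡ᵇ n +ℕ r) ≡ (m ≡ᵇ n)
≡ᵇ-+ʳ m n r = trans (cong₂ _≡ᵇ_ (ℕ.+-comm m r) (ℕ.+-comm n r)) (≡ᵇ-+ˡ r m n)

lengthWith : (V → V → ℕ) → {n : ℕ} → Vec V n → ℕ
lengthWith d []           = 0
lengthWith d (x ∷ [])     = 0
lengthWith d (x ∷ y ∷ xs) = d x y +ℕ lengthWith d (y ∷ xs)

len≡lengthWith : (S : GenSet) {n : ℕ} (x : Vec V n) → len S x ≡ lengthWith (dist S) x
len≡lengthWith S []           = refl
len≡lengthWith S (x ∷ [])     = refl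
len≡lengthWith S (x ∷ y ∷ xs) = cong (dist S x y +ℕ_) (len≡lengthWith S (y ∷ xs))

lengthWith-cong : {d d′ : V → V → ℕ} → (∀ x y → d x y ≡ d′ x y) → {n : ℕ} (x : Vec V n) → lengthWith d x ≡ lengthWith d′ x
lengthWith-cong d≗d′ []           = refl
lengthWith-cong d≗d′ (x ∷ [])     = refl
lengthWith-cong d≗d′ (x ∷ y ∷ xs) = cong₂ _+ℕ_ (d≗d′ x y) (lengthWith-cong d≗d′ (y ∷ xs))

-- Stated for an abstract d, so that dist is never unfolded while checking it.
lengthWith-insertAt : (d : V → V → ℕ) {k : ℕ} (y : Vec V (suc k)) (j : Fin k) (v : V) →
                      (lengthWith d y ≡ᵇ lengthWith d (insertAt y (Fin.suc (inject₁ j)) v))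
                      ≡ (d (lookup y (inject₁ j)) (lookup y (Fin.suc j))
                           ≡ᵇ d (lookup y (inject₁ j)) v +ℕ d v (lookup y (Fin.suc j)))
lengthWith-insertAt d (u ∷ w ∷ ys) Fin.zero v =
  trans (cong (d u w +ℕ lengthWith d (w ∷ ys) ≡ᵇ_) (sym (ℕ.+-assoc (d u v) (d v w) (lengthWith d (w ∷ ys)))))
        (≡ᵇ-+ʳ (d u w) (d u v +ℕ d v w) (lengthWith d (w ∷ ys)))
lengthWith-insertAt d (u ∷ w ∷ ys) (Fin.suc j) v =
  trans (≡ᵇ-+ˡ (d u w) (lengthWith d (w ∷ ys)) (lengthWith d (insertAt (w ∷ ys) (Fin.suc (inject₁ j)) v)))
        (lengthWith-insertAt d (w ∷ ys) j v)

VanishesOnRepeats : {k : ℕ} → Chain k → Set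
VanishesOnRepeats c = ∀ x → consecDistinct x ≡ false → c x ≡ 0ℤ

MC-vanishesOnRepeats : (S : GenSet) (k l : ℕ) (c : Chain k) → InMC S k l c → VanishesOnRepeats c
MC-vanishesOnRepeats S k l c c∈MC x repeats = c∈MC x (cong (_∧ (len S x ≡ᵇ l)) repeats)

repeat-not-distinct : {n : ℕ} (a : V) (xs : Vec V n) → consecDistinct (a ∷ a ∷ xs) ≡ false
repeat-not-distinct a xs rewrite ==V-refl a = refl

∷-not-distinct : {n : ℕ} (z a : V) (xs : Vec V n) → consecDistinct (a ∷ xs) ≡ false → consecDistinct (z ∷ a ∷ xs) ≡ false
∷-not-distinct z a xs h rewrite h = ∧-zeroʳ (not (z ==V a))

insertAt-left-repeat : {k : ℕ} (y : Vec V (suc k)) (j : Fin k) →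
                       consecDistinct (insertAt y (Fin.suc (inject₁ j)) (lookup y (inject₁ j))) ≡ false
insertAt-left-repeat (u ∷ w ∷ ys) Fin.zero    = repeat-not-distinct u (w ∷ ys)
insertAt-left-repeat (u ∷ w ∷ ys) (Fin.suc j) =
  ∷-not-distinct u w (insertAt ys (inject₁ j) (lookup (w ∷ ys) (inject₁ j))) (insertAt-left-repeat (w ∷ ys) j)

insertAt-right-repeat : {k : ℕ} (y : Vec V (suc k)) (j : Fin k) →
                        consecDistinct (insertAt y (Fin.suc (inject₁ j)) (lookup y (Fin.suc j))) ≡ false
insertAt-right-repeat (u ∷ w ∷ ys) Fin.zero    = ∷-not-distinct u w (w ∷ ys) (repeat-not-distinct w ys)
insertAt-right-repeat (u ∷ w ∷ ys) (Fin.suc j) =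
  ∷-not-distinct u w (insertAt ys (inject₁ j) (lookup (w ∷ ys) (Fin.suc j))) (insertAt-right-repeat (w ∷ ys) j)

<ᵇ-irrefl : (n : ℕ) → (n ℕ.<ᵇ n) ≡ false
<ᵇ-irrefl zero    = refl
<ᵇ-irrefl (suc n) = <ᵇ-irrefl n

last-face-vanishes : (S : GenSet) (k : ℕ) (x : Vec V (suc (suc k))) → faceCoefficient S k x (Fin.suc (fromℕ k)) ≡ 0ℤ
last-face-vanishes S k x =
  cong (λ b → if b ∧ (len S (removeAt x (Fin.suc (fromℕ k))) ≡ᵇ len S x) then sign (toℕ (Fin.suc (fromℕ k))) else 0ℤ)
       (trans (cong (ℕ._<ᵇ k) (Fin.toℕ-fromℕ k)) (<ᵇ-irrefl k))

if-∧-true : (a b c : Bool) (s : ℤ) → a ≡ true → b ≡ true → (if a ∧ b ∧ c then s else 0ℤ) ≡ (if c then s else 0ℤ)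
if-∧-true true true c s refl refl = refl

interior-face : (S : GenSet) {k : ℕ} (y : Vec V (suc k)) (j : Fin k) (v : V) →
                faceCoefficient S k (insertAt y (Fin.suc (inject₁ j)) v) (Fin.suc (inject₁ j))
                ≡ (if dist S (lookup y (inject₁ j)) (lookup y (Fin.suc j))
                        ≡ᵇ dist S (lookup y (inject₁ j)) v +ℕ dist S v (lookup y (Fin.suc j))
                   then sign (suc (toℕ j)) else 0ℤ)
interior-face S {k} y j v = begin
  faceCoefficient S k x i
    ≡⟨ if-∧-true (1 ≤ᵇ toℕ i) (toℕ i ≤ᵇ k) (len S (removeAt x i) ≡ᵇ len S x) (sign (toℕ i)) refl
                 (trans (cong (ℕ._<ᵇ k) (Fin.toℕ-inject₁ j)) (Equivalence.to T-≡ (ℕ.<⇒<ᵇ (Fin.toℕ<n j)))) ⟩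
  (if len S (removeAt x i) ≡ᵇ len S x then sign (toℕ i) else 0ℤ)
    ≡⟨ cong (λ z → if len S z ≡ᵇ len S x then sign (toℕ i) else 0ℤ) (Vec.removeAt-insertAt y i v) ⟩
  (if len S y ≡ᵇ len S x then sign (toℕ i) else 0ℤ)
    ≡⟨ cong₂ (λ b n → if b then sign n else 0ℤ)
             (trans (cong₂ _≡ᵇ_ (len≡lengthWith S y) (len≡lengthWith S x)) (lengthWith-insertAt (dist S) y j v))
             (cong suc (Fin.toℕ-inject₁ j)) ⟩
  (if dist S (lookup y (inject₁ j)) (lookup y (Fin.suc j))
        ≡ᵇ dist S (lookup y (inject₁ j)) v +ℕ dist S v (lookup y (Fin.suc j))
   then sign (suc (toℕ j)) else 0ℤ) ∎
  where
  open ≡-Reasoning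
  i = Fin.suc (inject₁ j)
  x = insertAt y i v

restrict-to-interval : (f : V → ℤ) (u w v : V) (g : Bool) (s : ℤ) → f u ≡ 0ℤ → f w ≡ 0ℤ →
                       f v * (if g then s else 0ℤ) ≡ s * (if g ∧ not (v ==V u) ∧ not (v ==V w) then f v else 0ℤ)
restrict-to-interval f u w v false s fu≡0 fw≡0 = trans (*-zeroʳ (f v)) (sym (*-zeroʳ s))
restrict-to-interval f u w v true  s fu≡0 fw≡0 with v ==V u in v≡u | v ==V w in v≡w
... | true  | _     rewrite ==V⇒≡ v≡u = trans (cong (_* s) fu≡0) (sym (*-zeroʳ s))
... | false | true  rewrite ==V⇒≡ v≡w = trans (cong (_* s) fw≡0) (sym (*-zeroʳ s))
... | false | false = *-comm (f v) s

interior-term : (S : GenSet) {k : ℕ} (b : Chain (suc k)) → VanishesOnRepeats b →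
                (y : Vec V (suc k)) (j : Fin k) →
                ∑[ v ← vertices ] (b (insertAt y (Fin.suc (inject₁ j)) v) * faceCoefficient S k (insertAt y (Fin.suc (inject₁ j)) v) (Fin.suc (inject₁ j)))
                ≡ sign (suc (toℕ j)) * ∑ (interval (dist S) (lookup y (inject₁ j)) (lookup y (Fin.suc j))) (b ∘ insertAt y (Fin.suc (inject₁ j)))
interior-term S {k} b b-vanishes y j = begin
  ∑[ v ← vertices ] (b (insertAt y (Fin.suc (inject₁ j)) v) * faceCoefficient S k (insertAt y (Fin.suc (inject₁ j)) v) (Fin.suc (inject₁ j)))
    ≡⟨ ∑-cong vertices (λ v → cong (f v *_) (interior-face S y j v)) ⟩
  ∑[ v ← vertices ] (f v * (if geodesic v then s else 0ℤ))
    ≡⟨ ∑-cong vertices (λ v → restrict-to-interval f u w v (geodesic v) s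
                                 (b-vanishes (f-arg u) (insertAt-left-repeat y j))
                                 (b-vanishes (f-arg w) (insertAt-right-repeat y j))) ⟩
  ∑[ v ← vertices ] (s * (if strictlyBetween (dist S) u w v then f v else 0ℤ))
    ≡⟨ ∑-*ˡ vertices s (λ v → if strictlyBetween (dist S) u w v then f v else 0ℤ) ⟩
  s * ∑[ v ← vertices ] (if strictlyBetween (dist S) u w v then f v else 0ℤ)
    ≡⟨ cong (s *_) (sym (∑-filterᵇ (strictlyBetween (dist S) u w) vertices f)) ⟩
  s * ∑ (filterᵇ (strictlyBetween (dist S) u w) vertices) f
    ≡⟨ cong (λ l → s * ∑ l f) (sym (interval-filterᵇ (dist S) u w)) ⟩
  sign (suc (toℕ j)) * ∑ (interval (dist S) (lookup y (inject₁ j)) (lookup y (Fin.suc j))) (b ∘ insertAt y (Fin.suc (inject₁ j))) ∎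
  where
  open ≡-Reasoning
  i = Fin.suc (inject₁ j)
  u = lookup y (inject₁ j)
  w = lookup y (Fin.suc j)
  s = sign (suc (toℕ j))
  f-arg : V → Vec V (suc (suc k))
  f-arg = insertAt y i
  f : V → ℤ
  f v = b (f-arg v)
  geodesic : V → Bool
  geodesic v = dist S u w ≡ᵇ dist S u v +ℕ dist S v w

∂-cofaces : (S : GenSet) (I : V → V → List V) → (∀ u w → interval (dist S) u w ≡ I u w) →
            (k : ℕ) (b : Chain (suc k)) → VanishesOnRepeats b →
            (y : Vec V (suc k)) → ∂ S k b y ≡ eval b (cofaces I k y)
∂-cofaces S I interval≡I k b b-vanishes y = begin
  ∂ S k b y
    ≡⟨ ∂-insertions S k b y ⟩
  ∑ (allFin (suc (suc k))) term
    ≡⟨ ∑-allFin-suc (suc k) term ⟩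
  term Fin.zero + ∑ (allFin (suc k)) (term ∘ Fin.suc)
    ≡⟨ cong₂ _+_ (vanishing-term Fin.zero (λ _ → refl)) (∑-allFin-last k (term ∘ Fin.suc)) ⟩
  0ℤ + (∑ (allFin k) interior + term (Fin.suc (fromℕ k)))
    ≡⟨ +-identityˡ _ ⟩
  ∑ (allFin k) interior + term (Fin.suc (fromℕ k))
    ≡⟨ cong (∑ (allFin k) interior +_) (vanishing-term (Fin.suc (fromℕ k)) (last-face-vanishes S k)) ⟩
  ∑ (allFin k) interior + 0ℤ
    ≡⟨ +-identityʳ _ ⟩
  ∑ (allFin k) interior
    ≡⟨ ∑-cong (allFin k) (λ j → trans (interior-term S b b-vanishes y j) (cong (λ l → sgn j * ∑ l (b ∘ ins j)) (interval≡I (lookup y (inject₁ j)) (lookup y (Fin.suc j))))) ⟩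
  ∑[ j ← allFin k ] (sgn j * ∑ (gap j) (b ∘ ins j))
    ≡⟨ ∑-cong (allFin k) (λ j → cong (sgn j *_) (trans (sym (∑-map (gap j) (ins j) b)) (sym (eval-units b (map (ins j) (gap j)))))) ⟩
  ∑[ j ← allFin k ] (sgn j * eval b (units (map (ins j) (gap j))))
    ≡⟨ ∑-cong (allFin k) (λ j → sym (eval-scale b (sgn j) _)) ⟩
  ∑[ j ← allFin k ] eval b (scale (sgn j) (units (map (ins j) (gap j))))
    ≡⟨ sym (eval-concatMap b (allFin k) _) ⟩
  eval b (cofaces I k y) ∎
  where
  open ≡-Reasoning
  term : Fin (suc (suc k)) → ℤ
  term i = ∑[ v ← vertices ] (b (insertAt y i v) * faceCoefficient S k (insertAt y i v) i)
  interior : Fin k → ℤ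
  interior j = term (Fin.suc (inject₁ j))
  sgn : Fin k → ℤ
  sgn j = sign (suc (toℕ j))
  ins : Fin k → V → Vec V (suc (suc k))
  ins j = insertAt y (Fin.suc (inject₁ j))
  gap : Fin k → List V
  gap j = I (lookup y (inject₁ j)) (lookup y (Fin.suc j))
  vanishing-term : (i : Fin (suc (suc k))) → (∀ x → faceCoefficient S k x i ≡ 0ℤ) → term i ≡ 0ℤ
  vanishing-term i coef≡0 = trans (∑-cong vertices (λ v → trans (cong (b (insertAt y i v) *_) (coef≡0 (insertAt y i v))) (*-zeroʳ (b (insertAt y i v))))) (∑-0 vertices)

∂-neg : (S : GenSet) (k : ℕ) (c : Chain (suc k)) (y : Vec V (suc k)) → ∂ S k (λ x → - c x) y ≡ - ∂ S k c y
∂-neg S k c y = begin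
  ∂ S k (λ x → - c x) y                                      ≡⟨ sym (∑-sumL tuples (λ x → - c x * bdryCoef S k x y)) ⟩
  ∑[ x ← tuples ] (- c x * bdryCoef S k x y)                 ≡⟨ ∑-cong tuples (λ x → trans (sym (neg-distribˡ-* (c x) _)) (sym (-1*i≡-i _))) ⟩
  ∑[ x ← tuples ] (-1ℤ * (c x * bdryCoef S k x y))           ≡⟨ ∑-*ˡ tuples -1ℤ (λ x → c x * bdryCoef S k x y) ⟩
  -1ℤ * ∑[ x ← tuples ] (c x * bdryCoef S k x y)             ≡⟨ -1*i≡-i _ ⟩
  - ∑[ x ← tuples ] (c x * bdryCoef S k x y)                 ≡⟨ cong -_ (∑-sumL tuples (λ x → c x * bdryCoef S k x y)) ⟩
  - ∂ S k c y                                                ∎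
  where
  open ≡-Reasoning
  tuples = allVecs (suc (suc k))

∂-indicator : (S : GenSet) (k : ℕ) (z : Vec V (suc (suc k))) (c : Chain (suc k)) →
              (∀ x → c x ≡ (if x ==Vec z then 1ℤ else 0ℤ)) → (y : Vec V (suc k)) → ∂ S k c y ≡ bdryCoef S k z y
∂-indicator S k z c c≗indicator y = begin
  ∂ S k c y
    ≡⟨ sym (∑-sumL tuples (λ x → c x * bdryCoef S k x y)) ⟩
  ∑[ x ← tuples ] (c x * bdryCoef S k x y)
    ≡⟨ ∑-cong tuples (λ x → trans (cong (_* bdryCoef S k x y) (c≗indicator x)) (indicator-* (x ==Vec z) (bdryCoef S k x y))) ⟩
  ∑[ x ← tuples ] (if x ==Vec z then bdryCoef S k x y else 0ℤ)
    ≡⟨ ∑-allVecs-indicator (suc (suc k)) z (λ x → bdryCoef S k x y) ⟩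
  bdryCoef S k z y ∎
  where
  open ≡-Reasoning
  tuples = allVecs (suc (suc k))
  indicator-* : (b : Bool) (t : ℤ) → (if b then 1ℤ else 0ℤ) * t ≡ (if b then t else 0ℤ)
  indicator-* true  t = *-identityˡ t
  indicator-* false t = refl

-- Magnitude

shift : ℕ → PS → PS
shift zero    g n       = g n
shift (suc i) g zero    = 0ℤ
shift (suc i) g (suc n) = shift i g n

sumL-zeros : (n : ℕ) → sumL (applyUpTo (λ _ → 0ℤ) n) ≡ 0ℤ
sumL-zeros zero    = refl
sumL-zeros (suc n) = trans (+-identityˡ _) (sumL-zeros n)

qPow-⊛ : (i : ℕ) (g : PS) (n : ℕ) → (qPow i ⊛ g) n ≡ shift i g n
qPow-⊛ zero    g n       = begin
  1ℤ * g n + sumL (List.map (λ j → qPow 0 j * g (n ∸ j)) (applyUpTo suc n))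
    ≡⟨ cong₂ _+_ (*-identityˡ (g n)) (trans (cong sumL (List.map-applyUpTo suc (λ j → qPow 0 j * g (n ∸ j)) n)) (sumL-zeros n)) ⟩
  g n + 0ℤ
    ≡⟨ +-identityʳ (g n) ⟩
  g n ∎
  where open ≡-Reasoning
qPow-⊛ (suc i) g zero    = refl
qPow-⊛ (suc i) g (suc n) = begin
  0ℤ + sumL (List.map (λ j → qPow (suc i) j * g (suc n ∸ j)) (applyUpTo suc (suc n)))
    ≡⟨ +-identityˡ _ ⟩
  sumL (List.map (λ j → qPow (suc i) j * g (suc n ∸ j)) (applyUpTo suc (suc n)))
    ≡⟨ cong sumL (List.map-applyUpTo suc (λ j → qPow (suc i) j * g (suc n ∸ j)) (suc n)) ⟩
  sumL (applyUpTo (λ j → qPow i j * g (n ∸ j)) (suc n))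
    ≡⟨ sym (cong sumL (List.map-applyUpTo id (λ j → qPow i j * g (n ∸ j)) (suc n))) ⟩
  (qPow i ⊛ g) n
    ≡⟨ qPow-⊛ i g n ⟩
  shift i g n ∎
  where open ≡-Reasoning

Coeffs : Set
Coeffs = ℤ × ℤ × ℤ

-- Coordinates in the basis I, A, B = J − I − A of the Bose–Mesner algebra of a strongly regular
-- graph with parameters (16, 6, 2, 2), where A² = 6I + 2A + 2B, AB = 3A + 4B, B² = 9I + 6A + 4B.
-- With Z = I + qA + q²B, the coefficient of q^(n+2) in Z W = I gives W_(n+2) = step W_(n+1) W_n.
step : Coeffs → Coeffs → Coeffs
step (a₁ , b₁ , c₁) (a₂ , b₂ , c₂) =
    - (ℤ.+ 6 * b₁ + ℤ.+ 9 * c₂)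
  , - (a₁ + ℤ.+ 2 * b₁ + ℤ.+ 3 * c₁ + ℤ.+ 3 * b₂ + ℤ.+ 6 * c₂)
  , - (ℤ.+ 2 * b₁ + ℤ.+ 4 * c₁ + a₂ + ℤ.+ 4 * b₂ + ℤ.+ 4 * c₂)

inverseCoeffs : ℕ → Coeffs
inverseCoeffs 0             = 1ℤ , 0ℤ , 0ℤ
inverseCoeffs 1             = 0ℤ , -1ℤ , 0ℤ
inverseCoeffs (suc (suc n)) = step (inverseCoeffs (suc n)) (inverseCoeffs n)

inverseEntry : ℕ → PS
inverseEntry 0             n = proj₁ (inverseCoeffs n)
inverseEntry 1             n = proj₁ (proj₂ (inverseCoeffs n))
inverseEntry (suc (suc _)) n = proj₂ (proj₂ (inverseCoeffs n))

Multiset : Set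
Multiset = List (ℕ × (ℕ × ℕ))

expand : Multiset → List (ℕ × ℕ)
expand = List.concatMap (λ (m , p) → replicate m p)

-- The multiplicities of (d(x,z), d(z,y)), z ∈ V, when d(x,y) = k, in a strongly regular graph
-- with parameters (16, 6, 2, 2).
profile : ℕ → Multiset
profile 0             = (1 , 0 , 0) ∷ (6 , 1 , 1) ∷ (9 , 2 , 2) ∷ []
profile 1             = (1 , 0 , 1) ∷ (1 , 1 , 0) ∷ (2 , 1 , 1) ∷ (3 , 1 , 2) ∷ (3 , 2 , 1) ∷ (6 , 2 , 2) ∷ []
profile (suc (suc _)) = (1 , 0 , 2) ∷ (2 , 1 , 1) ∷ (4 , 1 , 2) ∷ (1 , 2 , 0) ∷ (4 , 2 , 1) ∷ (4 , 2 , 2) ∷ []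

profileTerm : ℕ → ℕ × ℕ → ℤ
profileTerm n (i , j) = shift i (inverseEntry j) n

∑-replicate : {A : Set} (m : ℕ) (x : A) (f : A → ℤ) → ∑ (replicate m x) f ≡ ℤ.+ m * f x
∑-replicate zero    x f = trans (∑-[] f) (sym (*-zeroˡ (f x)))
∑-replicate (suc m) x f =
  trans (∑-∷ x _ f) (trans (cong (f x +_) (∑-replicate m x f)) (sym (suc-* (ℤ.+ m) (f x))))

∑-expand : (M : Multiset) (f : ℕ × ℕ → ℤ) → ∑ (expand M) f ≡ ∑[ mp ← M ] (ℤ.+ proj₁ mp * f (proj₂ mp))
∑-expand M f = trans (∑-concatMap M _ f) (∑-cong M (λ (m , p) → ∑-replicate m p f))

opaque
  unfolding ∑

  profile-sum : (k n : ℕ) → ∑[ mp ← profile k ] (ℤ.+ proj₁ mp * profileTerm n (proj₂ mp)) ≡ (if k ≡ᵇ 0 then 1ps else 0ps) n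
  profile-sum 0             0             = refl
  profile-sum 0             1             = refl
  profile-sum 0             (suc (suc n)) = cancel (inverseEntry 1 (suc n)) (inverseEntry 2 n)
    where
    cancel : ∀ b c → ℤ.+ 1 * - (ℤ.+ 6 * b + ℤ.+ 9 * c) + (ℤ.+ 6 * b + (ℤ.+ 9 * c + 0ℤ)) ≡ 0ℤ
    cancel = solve-∀
  profile-sum 1             0             = refl
  profile-sum 1             1             = refl
  profile-sum 1             (suc (suc n)) =
    cancel (inverseEntry 0 (suc n)) (inverseEntry 1 (suc n)) (inverseEntry 2 (suc n)) (inverseEntry 1 n) (inverseEntry 2 n)
    where
    cancel : ∀ a₁ b₁ c₁ b₂ c₂ →
      ℤ.+ 1 * - (a₁ + ℤ.+ 2 * b₁ + ℤ.+ 3 * c₁ + ℤ.+ 3 * b₂ + ℤ.+ 6 * c₂)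
      + (ℤ.+ 1 * a₁ + (ℤ.+ 2 * b₁ + (ℤ.+ 3 * c₁ + (ℤ.+ 3 * b₂ + (ℤ.+ 6 * c₂ + 0ℤ))))) ≡ 0ℤ
    cancel = solve-∀
  profile-sum (suc (suc k)) 0             = refl
  profile-sum (suc (suc k)) 1             = refl
  profile-sum (suc (suc k)) (suc (suc n)) =
    cancel (inverseEntry 1 (suc n)) (inverseEntry 2 (suc n)) (inverseEntry 0 n) (inverseEntry 1 n) (inverseEntry 2 n)
    where
    cancel : ∀ b₁ c₁ a₂ b₂ c₂ →
      ℤ.+ 1 * - (ℤ.+ 2 * b₁ + ℤ.+ 4 * c₁ + a₂ + ℤ.+ 4 * b₂ + ℤ.+ 4 * c₂)
      + (ℤ.+ 2 * b₁ + (ℤ.+ 4 * c₁ + (ℤ.+ 1 * a₂ + (ℤ.+ 4 * b₂ + (ℤ.+ 4 * c₂ + 0ℤ))))) ≡ 0ℤ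
    cancel = solve-∀

dist₂ : GenSet → V → V → ℕ
dist₂ S x y = if x ==V y then 0 else (if adj S x y then 1 else 2)

pairs : GenSet → V → V → List (ℕ × ℕ)
pairs S x y = map (λ z → dist₂ S x z , dist₂ S z y) vertices

sumPS-at : (L : List PS) (n : ℕ) → sumPS L n ≡ ∑[ f ← L ] f n
sumPS-at []      n = sym (∑-[] _)
sumPS-at (f ∷ L) n = trans (cong (f n +_) (sumPS-at L n)) (sym (∑-∷ f L _))

identity-by-distance : (S : GenSet) (x y : V) (n : ℕ) →
                       (if dist₂ S x y ≡ᵇ 0 then 1ps else 0ps) n ≡ idM x y n
identity-by-distance S x y n with x ==V y | adj S x y
... | true  | _     = refl
... | false | true  = refl
... | false | false = refl

module DiameterTwo (S : GenSet)
  (diameter≤2 : ∀ x y → dist S x y ≡ dist₂ S x y)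
  (profiled : ∀ x y → sort (pairs S x y) ≡ expand (profile (dist₂ S x y)))
  where

  W : Matrix
  W x y = inverseEntry (dist S x y)

  W-inverse : IsInverse (ZG S) W
  W-inverse x y n = begin
    (ZG S · W) x y n
      ≡⟨ sumPS-at (map (λ z → ZG S x z ⊛ W z y) vertices) n ⟩
    ∑[ f ← map (λ z → ZG S x z ⊛ W z y) vertices ] f n
      ≡⟨ ∑-map vertices (λ z → ZG S x z ⊛ W z y) (λ f → f n) ⟩
    ∑[ z ← vertices ] (qPow (dist S x z) ⊛ inverseEntry (dist S z y)) n
      ≡⟨ ∑-cong vertices (λ z → trans (cong₂ (λ d e → (qPow d ⊛ inverseEntry e) n) (diameter≤2 x z) (diameter≤2 z y))
                                        (qPow-⊛ (dist₂ S x z) (inverseEntry (dist₂ S z y)) n)) ⟩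
    ∑[ z ← vertices ] profileTerm n (dist₂ S x z , dist₂ S z y)
      ≡⟨ sym (∑-map vertices (λ z → dist₂ S x z , dist₂ S z y) (profileTerm n)) ⟩
    ∑ (pairs S x y) (profileTerm n)
      ≡⟨ sym (∑-↭ (profileTerm n) (sort-↭ (pairs S x y))) ⟩
    ∑ (sort (pairs S x y)) (profileTerm n)
      ≡⟨ cong (λ l → ∑ l (profileTerm n)) (profiled x y) ⟩
    ∑ (expand (profile (dist₂ S x y))) (profileTerm n)
      ≡⟨ ∑-expand (profile (dist₂ S x y)) (profileTerm n) ⟩
    ∑[ mp ← profile (dist₂ S x y) ] (ℤ.+ proj₁ mp * profileTerm n (proj₂ mp))
      ≡⟨ profile-sum (dist₂ S x y) n ⟩
    (if dist₂ S x y ≡ᵇ 0 then 1ps else 0ps) n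
      ≡⟨ identity-by-distance S x y n ⟩
    idM x y n ∎
    where open ≡-Reasoning

  row-sum : (x : V) (n : ℕ) → ∑[ y ← vertices ] W x y n ≡ ∑[ mp ← profile 0 ] (ℤ.+ proj₁ mp * inverseEntry (proj₁ (proj₂ mp)) n)
  row-sum x n = begin
    ∑[ y ← vertices ] inverseEntry (dist S x y) n
      ≡⟨ ∑-cong vertices (λ y → cong (λ d → inverseEntry d n) (diameter≤2 x y)) ⟩
    ∑[ y ← vertices ] inverseEntry (dist₂ S x y) n
      ≡⟨ sym (∑-map vertices (λ z → dist₂ S x z , dist₂ S z x) (λ p → inverseEntry (proj₁ p) n)) ⟩
    ∑[ p ← pairs S x x ] inverseEntry (proj₁ p) n
      ≡⟨ sym (∑-↭ (λ p → inverseEntry (proj₁ p) n) (sort-↭ (pairs S x x))) ⟩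
    ∑[ p ← sort (pairs S x x) ] inverseEntry (proj₁ p) n
      ≡⟨ cong (λ l → ∑[ p ← l ] inverseEntry (proj₁ p) n) (trans (profiled x x) (cong (λ b → expand (profile (if b then 0 else (if adj S x x then 1 else 2)))) (==V-refl x))) ⟩
    ∑[ p ← expand (profile 0) ] inverseEntry (proj₁ p) n
      ≡⟨ ∑-expand (profile 0) (λ p → inverseEntry (proj₁ p) n) ⟩
    ∑[ mp ← profile 0 ] (ℤ.+ proj₁ mp * inverseEntry (proj₁ (proj₂ mp)) n) ∎
    where open ≡-Reasoning

  sumEntries-W : (n : ℕ) → sumEntries W n ≡ ∑[ _ ← vertices ] ∑[ mp ← profile 0 ] (ℤ.+ proj₁ mp * inverseEntry (proj₁ (proj₂ mp)) n)
  sumEntries-W n = begin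
    sumEntries W n
      ≡⟨ sumPS-at (concatMap (λ x → map (W x) vertices) vertices) n ⟩
    ∑[ f ← concatMap (λ x → map (W x) vertices) vertices ] f n
      ≡⟨ ∑-concatMap vertices (λ x → map (W x) vertices) (λ f → f n) ⟩
    ∑[ x ← vertices ] ∑[ f ← map (W x) vertices ] f n
      ≡⟨ ∑-cong vertices (λ x → trans (∑-map vertices (W x) (λ f → f n)) (row-sum x n)) ⟩
    ∑[ _ ← vertices ] ∑[ mp ← profile 0 ] (ℤ.+ proj₁ mp * inverseEntry (proj₁ (proj₂ mp)) n) ∎
    where open ≡-Reasoning

srg-magnitude : PS
srg-magnitude n = ∑[ _ ← vertices ] ∑[ mp ← profile 0 ] (ℤ.+ proj₁ mp * inverseEntry (proj₁ (proj₂ mp)) n)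

magnitude-of-diameter-two : (S : GenSet) → (∀ x y → dist S x y ≡ dist₂ S x y) →
                            (∀ x y → sort (pairs S x y) ≡ expand (profile (dist₂ S x y))) →
                            IsMagnitude S srg-magnitude
magnitude-of-diameter-two S diameter≤2 profiled = W , W-inverse , λ n → sym (sumEntries-W n)
  where open DiameterTwo S diameter≤2 profiled

diameter≤2-R44 : ∀ x y → dist S-R44 x y ≡ dist₂ S-R44 x y
diameter≤2-R44 = decide-∀V² (λ x y → dist S-R44 x y ℕ.≟ dist₂ S-R44 x y)

profiled-R44 : ∀ x y → sort (pairs S-R44 x y) ≡ expand (profile (dist₂ S-R44 x y))
profiled-R44 = decide-∀V² (λ x y → List.≡-dec (Product.≡-dec ℕ._≟_ ℕ._≟_) (sort (pairs S-R44 x y)) (expand (profile (dist₂ S-R44 x y))))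

diameter≤2-Shr : ∀ x y → dist S-Shr x y ≡ dist₂ S-Shr x y
diameter≤2-Shr = decide-∀V² (λ x y → dist S-Shr x y ℕ.≟ dist₂ S-Shr x y)

profiled-Shr : ∀ x y → sort (pairs S-Shr x y) ≡ expand (profile (dist₂ S-Shr x y))
profiled-Shr = decide-∀V² (λ x y → List.≡-dec (Product.≡-dec ℕ._≟_ ℕ._≟_) (sort (pairs S-Shr x y)) (expand (profile (dist₂ S-Shr x y))))

-- Every cycle of MC_{3,4}(R_{4,4}) bounds

_==F_ : Fin 4 → Fin 4 → Bool
a ==F b = does (a Fin.≟ b)

rookDistance : V → V → ℕ
rookDistance (a , b) (a′ , b′) = (if a ==F a′ then 0 else 1) +ℕ (if b ==F b′ then 0 else 1)

dist-R44 : ∀ x y → dist S-R44 x y ≡ rookDistance x y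
dist-R44 = decide-∀V² (λ x y → dist S-R44 x y ℕ.≟ rookDistance x y)

corners : V → V → List V
corners (a , b) (a′ , b′) =
  if (a ==F a′) ∨ (b ==F b′) then []
  else if toℕ a <ᵇ toℕ a′ then (a , b′) ∷ (a′ , b) ∷ [] else (a′ , b) ∷ (a , b′) ∷ []

corners-between : ∀ u w → filterᵇ (strictlyBetween rookDistance u w) vertices ≡ corners u w
corners-between = decide-∀V² (λ u w → List.≡-dec _≟V_ (filterᵇ (strictlyBetween rookDistance u w) vertices) (corners u w))

interval-R44 : ∀ u w → interval (dist S-R44) u w ≡ corners u w
interval-R44 u w =
  trans (interval-cong dist-R44 u w) (trans (interval-filterᵇ rookDistance u w) (corners-between u w))

horizontal vertical diagonal : V → V → Bool
horizontal (a , b) (a′ , b′) = not (a ==F a′) ∧ (b ==F b′)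
vertical   (a , b) (a′ , b′) = (a ==F a′) ∧ not (b ==F b′)
diagonal   (a , b) (a′ , b′) = not (a ==F a′) ∧ not (b ==F b′)

isRookGenerator : (l : ℕ) {n : ℕ} → Vec V n → Bool
isRookGenerator l x = consecDistinct x ∧ (lengthWith rookDistance x ≡ᵇ l)

-- A generator of MC_{4,4}(R_{4,4}) is a path of four unit steps, each horizontal or vertical;
-- the table is indexed by which steps are horizontal.
contractionTable : Vec V 5 → Formal 4
contractionTable (x₀ ∷ x₁ ∷ x₂ ∷ x₃ ∷ x₄ ∷ []) =
  table (horizontal x₀ x₁) (horizontal x₁ x₂) (horizontal x₂ x₃) (horizontal x₃ x₄)
  where
  skip₁ skip₂ skip₃ : Vec V 4
  skip₁ = x₀ ∷ x₂ ∷ x₃ ∷ x₄ ∷ []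
  skip₂ = x₀ ∷ x₁ ∷ x₃ ∷ x₄ ∷ []
  skip₃ = x₀ ∷ x₁ ∷ x₂ ∷ x₄ ∷ []
  table : Bool → Bool → Bool → Bool → Formal 4
  table true  false false false = (skip₁ , - 1ℤ) ∷ ((x₀ ∷ (proj₁ x₀ , proj₂ x₂) ∷ x₃ ∷ x₄ ∷ []) , - 1ℤ) ∷ []
  table false true  false false = (skip₂ , 1ℤ) ∷ []
  table false false false true  = (skip₃ , - 1ℤ) ∷ []
  table true  true  true  false = (skip₃ , - 1ℤ) ∷ ((x₀ ∷ x₁ ∷ (proj₁ x₂ , proj₂ x₄) ∷ x₄ ∷ []) , - 1ℤ) ∷ []
  table true  true  false true  = (skip₂ , 1ℤ) ∷ []
  table false true  true  true  = (skip₁ , - 1ℤ) ∷ []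
  table true  true  false false = (skip₂ , 1ℤ) ∷ ((x₀ ∷ (proj₁ x₀ , proj₂ x₃) ∷ (proj₁ x₁ , proj₂ x₃) ∷ x₄ ∷ []) , - 1ℤ)
                                  ∷ ((x₀ ∷ (proj₁ x₁ , proj₂ x₃) ∷ x₃ ∷ x₄ ∷ []) , 1ℤ) ∷ []
  table true  false true  false = ((x₀ ∷ (proj₁ x₀ , proj₂ x₂) ∷ x₂ ∷ x₄ ∷ []) , 1ℤ) ∷ (skip₁ , - 1ℤ) ∷ []
  table true  false false true  = (skip₁ , - 1ℤ) ∷ []
  table false true  true  false = (skip₃ , - 1ℤ) ∷ []
  table false false true  true  = (skip₂ , 1ℤ) ∷ []
  table _     _     _     _     = []

contractionTerms : Vec V 5 → Formal 4
contractionTerms x = if isRookGenerator 4 x then contractionTable x else []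

horizontal-vertical-diagonal : Vec V 4 → Bool
horizontal-vertical-diagonal (y₀ ∷ y₁ ∷ y₂ ∷ y₃ ∷ []) = horizontal y₀ y₁ ∧ vertical y₁ y₂ ∧ diagonal y₂ y₃

correction : Vec V 4 → Formal 4
correction y = if horizontal-vertical-diagonal y then cofaces corners 2 (removeAt y (Fin.suc Fin.zero)) else []

-- What ∂(contraction c) y equals by the finite check: c y, plus (∂c)(y₀, y₂, y₃) when the steps
-- of y are horizontal, vertical, diagonal; so ∂(contraction c) = c for every cycle c.
contractionTarget : Vec V 4 → Formal 4
contractionTarget y = if isRookGenerator 4 y then (y , 1ℤ) ∷ correction y else []

contractionDefect : Vec V 4 → Formal 4
contractionDefect y = bind contractionTerms (cofaces corners 3 y) ++ scale -1ℤ (contractionTarget y)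

contractionDefect-vanishes : ∀ y → T (null (normalise (contractionDefect y)))
contractionDefect-vanishes = decide-∀ (λ y → T? (null (normalise (contractionDefect y)))) (allVecs 4) allVecs-complete

contraction : Chain 3 → Chain 4
contraction c x = eval c (contractionTerms x)

isGen-R44 : (k l : ℕ) (x : Vec V (suc k)) → isGen S-R44 k l x ≡ isRookGenerator l x
isGen-R44 k l x =
  cong (λ m → consecDistinct x ∧ (m ≡ᵇ l)) (trans (len≡lengthWith S-R44 x) (lengthWith-cong dist-R44 x))

null⇒≡[] : {A : Set} (xs : List A) → T (null xs) → xs ≡ []
null⇒≡[] [] _ = refl

module _ (c : Chain 3) (c∈MC : InMC S-R44 3 4 c) (c-cycle : ∀ w → ∂ S-R44 2 c w ≡ 0ℤ) where

  contraction∈MC : InMC S-R44 4 4 (contraction c)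
  contraction∈MC x not-generator =
    trans (cong (λ g → eval c (if g then contractionTable x else [])) (trans (sym (isGen-R44 4 4 x)) not-generator))
          (eval-[] c)

  correction-vanishes : ∀ y → eval c (correction y) ≡ 0ℤ
  correction-vanishes y = by-cases (horizontal-vertical-diagonal y)
    where
    by-cases : ∀ g → eval c (if g then cofaces corners 2 (removeAt y (Fin.suc Fin.zero)) else []) ≡ 0ℤ
    by-cases true  = trans (sym (∂-cofaces S-R44 corners interval-R44 2 c (MC-vanishesOnRepeats S-R44 3 4 c c∈MC) w)) (c-cycle w)
      where w = removeAt y (Fin.suc Fin.zero)
    by-cases false = eval-[] c

  eval-contractionTarget : ∀ y → eval c (contractionTarget y) ≡ c y
  eval-contractionTarget y = by-cases (isRookGenerator 4 y) refl
    where
    by-cases : ∀ g → isRookGenerator 4 y ≡ g → eval c (if g then (y , 1ℤ) ∷ correction y else []) ≡ c y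
    by-cases true  _         = trans (eval-∷ c y 1ℤ (correction y))
                                     (trans (cong₂ _+_ (*-identityˡ (c y)) (correction-vanishes y)) (+-identityʳ (c y)))
    by-cases false generator = trans (eval-[] c) (sym (c∈MC y (trans (isGen-R44 3 4 y) generator)))

  ∂-contraction : ∀ y → ∂ S-R44 3 (contraction c) y ≡ c y
  ∂-contraction y = begin
    ∂ S-R44 3 (contraction c) y
      ≡⟨ ∂-cofaces S-R44 corners interval-R44 3 (contraction c) (MC-vanishesOnRepeats S-R44 4 4 (contraction c) contraction∈MC) y ⟩
    eval (contraction c) (cofaces corners 3 y)
      ≡⟨ sym (eval-bind c contractionTerms (cofaces corners 3 y)) ⟩
    eval c (bind contractionTerms (cofaces corners 3 y))
      ≡⟨ eval-difference c _ (contractionTarget y) (eval-vanishes c (contractionDefect y) (null⇒≡[] _ (contractionDefect-vanishes y))) ⟩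
    eval c (contractionTarget y)
      ≡⟨ eval-contractionTarget y ⟩
    c y ∎
    where open ≡-Reasoning

-- A nontrivial class in MH_{3,4}(Shrikhande)

shrikhandePath : Vec V 4
shrikhandePath = (# 0 , # 0) ∷ (# 1 , # 0) ∷ (# 3 , # 1) ∷ (# 0 , # 2) ∷ []

shrikhandeChain : Chain 3
shrikhandeChain x = if x ==Vec shrikhandePath then 1ℤ else 0ℤ

shrikhandeChain∈MC : InMC S-Shr 3 4 shrikhandeChain
shrikhandeChain∈MC x not-generator with x ==Vec shrikhandePath in x≡path
... | true  = ⊥-elim (path-is-generator (subst (λ z → isGen S-Shr 3 4 z ≡ false) (==Vec⇒≡ x≡path) not-generator))
  where
  path-is-generator : isGen S-Shr 3 4 shrikhandePath ≢ false
  path-is-generator ()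
... | false = refl

shrikhandeChain-cycle : ∀ y → ∂ S-Shr 2 shrikhandeChain y ≡ 0ℤ
shrikhandeChain-cycle y = trans (∂-indicator S-Shr 2 shrikhandePath shrikhandeChain (λ _ → refl) y) refl

via : V → V → Vec V 4
via a b = (# 0 , # 0) ∷ a ∷ b ∷ (# 0 , # 2) ∷ []

shrikhandeCocycle : Formal 4
shrikhandeCocycle =
    (via (# 1 , # 0) (# 2 , # 0) , 1ℤ)  ∷ (via (# 1 , # 0) (# 3 , # 1) , 1ℤ)  ∷ (via (# 1 , # 1) (# 2 , # 1) , -1ℤ)
  ∷ (via (# 1 , # 1) (# 2 , # 2) , -1ℤ) ∷ (via (# 1 , # 1) (# 3 , # 2) , -1ℤ) ∷ (via (# 2 , # 0) (# 1 , # 3) , -1ℤ)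
  ∷ (via (# 2 , # 1) (# 3 , # 1) , 1ℤ)  ∷ (via (# 2 , # 2) (# 1 , # 2) , 1ℤ)  ∷ (via (# 2 , # 3) (# 1 , # 2) , 1ℤ)
  ∷ (via (# 3 , # 0) (# 1 , # 3) , -1ℤ) ∷ (via (# 3 , # 0) (# 2 , # 3) , -1ℤ) ∷ (via (# 3 , # 3) (# 1 , # 2) , 1ℤ)
  ∷ []

opaque
  unfolding eval

  cocycle-detects-path : eval shrikhandeChain shrikhandeCocycle ≡ 1ℤ
  cocycle-detects-path = refl

cocycle-kills-boundaries : (b : Chain 4) → InMC S-Shr 4 4 b → eval (∂ S-Shr 3 b) shrikhandeCocycle ≡ 0ℤ
cocycle-kills-boundaries b b∈MC = begin
  eval (∂ S-Shr 3 b) shrikhandeCocycle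
    ≡⟨ eval-cong shrikhandeCocycle (∂-cofaces S-Shr I interval-filterᵇ′ 3 b (MC-vanishesOnRepeats S-Shr 4 4 b b∈MC)) ⟩
  eval (λ z → eval b (cofaces I 3 z)) shrikhandeCocycle
    ≡⟨ sym (eval-bind b (cofaces I 3) shrikhandeCocycle) ⟩
  eval b (bind (cofaces I 3) shrikhandeCocycle)
    ≡⟨ eval-vanishes b (bind (cofaces I 3) shrikhandeCocycle) refl ⟩
  0ℤ ∎
  where
  open ≡-Reasoning
  -- dist₂ evaluates much faster than dist.
  I : V → V → List V
  I u w = filterᵇ (strictlyBetween (dist₂ S-Shr) u w) vertices
  interval-filterᵇ′ : ∀ u w → interval (dist S-Shr) u w ≡ I u w
  interval-filterᵇ′ u w = trans (interval-cong diameter≤2-Shr u w) (interval-filterᵇ (dist₂ S-Shr) u w)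

no-isomorphism : {c ℓ c′ ℓ′ : Level} {A : Set} (G : RawGroup c ℓ) (H : RawGroup c′ ℓ′) →
                 let module G = RawGroup G; module H = RawGroup H in
                 (φ : H.Carrier → A) → (∀ {a b} → a H.≈ b → φ a ≡ φ b) →
                 (∀ x → G.ε G.≈ x) → (y : H.Carrier) → φ y ≢ φ H.ε →
                 ¬ Σ (G.Carrier → H.Carrier) (GroupMorphisms.IsGroupIsomorphism G H)
no-isomorphism G H φ φ-invariant G-trivial y φy≢φε (f , isomorphism) =
  φy≢φε (trans (sym (φ-invariant fε≈y)) (φ-invariant ε-homo))
  where
  open GroupMorphisms.IsGroupIsomorphism isomorphism
  fε≈y : RawGroup._≈_ H (f (RawGroup.ε G)) y
  fε≈y = proj₂ (surjective y) (G-trivial (proj₁ (surjective y)))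

R44-cycles-bound : (x : Cycle S-R44 3 4) → Homologous S-R44 3 4 (RawGroup.ε (MH S-R44 3 4)) x
R44-cycles-bound (c , c∈MC , c-cycle) = (λ z → - contraction c z) , −contraction∈MC , boundary
  where
  −contraction∈MC : InMC S-R44 4 4 (λ z → - contraction c z)
  −contraction∈MC z not-generator = cong -_ (contraction∈MC c c∈MC c-cycle z not-generator)
  boundary : ∀ y → 0ℤ - c y ≡ ∂ S-R44 3 (λ z → - contraction c z) y
  boundary y = trans (+-identityˡ (- c y))
                     (sym (trans (∂-neg S-R44 3 (contraction c) y) (cong -_ (∂-contraction c c∈MC c-cycle y))))

shrikhandeClass : Cycle S-Shr 3 4
shrikhandeClass = shrikhandeChain , shrikhandeChain∈MC , shrikhandeChain-cycle

shrikhandePairing : Cycle S-Shr 3 4 → ℤ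
shrikhandePairing z = eval (proj₁ z) shrikhandeCocycle

shrikhandePairing-invariant : ∀ {z z′} → Homologous S-Shr 3 4 z z′ → shrikhandePairing z ≡ shrikhandePairing z′
shrikhandePairing-invariant {c , _} {c′ , _} (b , b∈MC , c-c′≡∂b) = i-j≡0⇒i≡j (eval c shrikhandeCocycle) (eval c′ shrikhandeCocycle) (begin
  eval c shrikhandeCocycle - eval c′ shrikhandeCocycle     ≡⟨ sym (eval-- c c′ shrikhandeCocycle) ⟩
  eval (λ y → c y - c′ y) shrikhandeCocycle                ≡⟨ eval-cong shrikhandeCocycle c-c′≡∂b ⟩
  eval (∂ S-Shr 3 b) shrikhandeCocycle                     ≡⟨ cocycle-kills-boundaries b b∈MC ⟩
  0ℤ                                                       ∎)
  where open ≡-Reasoning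

propositionA2 : (Σ PS λ m → IsMagnitude S-R44 m × IsMagnitude S-Shr m)
                × (∃[ k ] ∃[ l ] ¬ (Σ (Cycle S-R44 k l → Cycle S-Shr k l) λ f →
                     GroupMorphisms.IsGroupIsomorphism (MH S-R44 k l) (MH S-Shr k l) f))
propositionA2 =
  ( srg-magnitude
  , magnitude-of-diameter-two S-R44 diameter≤2-R44 profiled-R44
  , magnitude-of-diameter-two S-Shr diameter≤2-Shr profiled-Shr )
  , 3 , 4 , no-isomorphism (MH S-R44 3 4) (MH S-Shr 3 4) shrikhandePairing (λ {z} {z′} → shrikhandePairing-invariant {z} {z′}) R44-cycles-bound shrikhandeClass
                           (λ 1≡0 → 1≢0 (trans (sym cocycle-detects-path) (trans 1≡0 (eval-zero shrikhandeCocycle))))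
  where
  1≢0 : 1ℤ ≢ 0ℤ
  1≢0 ()
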